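{- (i) For every integer $n\ge 5$, $o_E(\Lambda_n) = o_V(\Gamma_{n-3})$. (ii) For every positive integer $n$, \[ o_E(\Lambda_n) = \frac{1}{2}\left(F_{n-1} + F_{\lfloor \frac{n+1+(-1)^n}{2}\rfloor}\right). \]
   Context: A Fibonacci string is a binary string with no two consecutive 1s; the Fibonacci cube $\Gamma_m$ is the subgraph of the $m$-cube $Q_m$ (binary strings of length $m$, adjacent iff they differ in exactly one position) induced by the Fibonacci strings of length $m$. A Lucas string of length $n$ is a Fibonacci string $u_1\cdots u_n$ that does not have both $u_1=1$ and $u_n=1$; the Lucas cube $\Lambda_n$ is the subgraph of $Q_n$ induced by the Lucas strings of length $n$. For a graph $G$, $o_V(G)$ is the number of orbits of the automorphism group ${\rm Aut}(G)$ acting on $V(G)$, and $o_E(G)$ is the number of orbits of ${\rm Aut}(G)$ acting on $E(G)$ via $\{u,v\}\mapsto\{g(u),g(v)\}$. $F_m$ are Fibonacci numbers with $F_0=0$, $F_1=1$. -}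

module Defs where

open import Data.Bool using (Bool; true; false; not; _∧_)
open import Data.Nat using (ℕ; zero; suc; _+_; _∸_; _/_)
open import Data.Vec using (Vec; []; _∷_; last)
open import Data.Fin using (Fin)
open import Data.Product using (Σ; _×_; ∃; _,_)
open import Data.Sum using (_⊎_)
open import Relation.Binary.PropositionalEquality using (_≡_)
import Data.Integer as ℤ

F : ℕ → ℕ
F zero = zero
F (suc zero) = suc zero
F (suc (suc n)) = F (suc n) + F n

noCons : ∀ {n} → Vec Bool n → Bool
noCons [] = true
noCons (x ∷ []) = true
noCons (x ∷ y ∷ xs) = not (x ∧ y) ∧ noCons (y ∷ xs)

lucasOk : ∀ {n} → Vec Bool n → Bool
lucasOk [] = true
lucasOk (x ∷ xs) = noCons (x ∷ xs) ∧ not (x ∧ last (x ∷ xs))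

bdiff : Bool → Bool → ℕ
bdiff true false = 1
bdiff false true = 1
bdiff _ _ = 0

hamming : ∀ {n} → Vec Bool n → Vec Bool n → ℕ
hamming [] [] = 0
hamming (x ∷ xs) (y ∷ ys) = bdiff x y + hamming xs ys

record Graph : Set₁ where
  field
    V   : Set
    Adj : V → V → Set

induced : (m : ℕ) → (Vec Bool m → Bool) → Graph
induced m P = record
  { V   = Σ (Vec Bool m) (λ u → P u ≡ true)
  ; Adj = λ u v → hamming (Σ.proj₁ u) (Σ.proj₁ v) ≡ 1 }

Γ : ℕ → Graph
Γ m = induced m noCons

Λ : ℕ → Graph
Λ n = induced n lucasOk

record Aut (G : Graph) : Set where
  open Graph G
  field
    to      : V → V
    from    : V → V
    to-from : ∀ v → to (from v) ≡ v
    from-to : ∀ v → from (to v) ≡ v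
    adj⇒    : ∀ u v → Adj u v → Adj (to u) (to v)
    adj⇐    : ∀ u v → Adj (to u) (to v) → Adj u v

module _ (G : Graph) where
  open Graph G

  SameVOrbit : V → V → Set
  SameVOrbit u v = ∃ λ (g : Aut G) → Aut.to g u ≡ v

  -- edges, represented by an adjacent ordered pair (u , v); the edge is {u , v}
  Edge : Set
  Edge = Σ V λ u → Σ V λ v → Adj u v

  SameEOrbit : Edge → Edge → Set
  SameEOrbit (u , v , _) (u' , v' , _) =
    ∃ λ (g : Aut G) →
      (Aut.to g u ≡ u' × Aut.to g v ≡ v') ⊎ (Aut.to g u ≡ v' × Aut.to g v ≡ u')

  -- "Aut(G) has exactly k orbits on V(G)": a system of k pairwise
  -- inequivalent orbit representatives covering all vertices
  HasVertexOrbits : ℕ → Set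
  HasVertexOrbits k = Σ (Fin k → V) λ r →
    (∀ v → ∃ λ i → SameVOrbit (r i) v) ×
    (∀ i j → SameVOrbit (r i) (r j) → i ≡ j)

  HasEdgeOrbits : ℕ → Set
  HasEdgeOrbits k = Σ (Fin k → Edge) λ r →
    (∀ e → ∃ λ i → SameEOrbit (r i) e) ×
    (∀ i j → SameEOrbit (r i) (r j) → i ≡ j)

-- ⌊ (n + 1 + (-1)^n) / 2 ⌋ ; the numerator is ≥ 0 for n ≥ 1 (indeed n ≥ 0),
-- so the floor is natural-number division of its absolute value
idx : ℕ → ℕ
idx n = ℤ.∣ ℤ.+ n ℤ.+ ℤ.+ 1 ℤ.+ (ℤ.- ℤ.+ 1) ℤ.^ n ∣ / 2

module Submission where

-- Write n = m + 3.  The proof identifies the orbits explicitly.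
--
-- If a family P of binary strings contains 0 and all unit
--   vectors, is closed under switching a 1 off, and every nonzero member has
--   a coordinate whose switching-on leaves P, then every automorphism of the
--   induced subgraph of the hypercube fixes 0 and acts on strings by a
--   permutation of the coordinates.  This applies to Γ_M (M ≥ 2) and to
--   Λ_n (n ≥ 3).
-- * Such a permutation preserves the "forbidden pairs" of coordinates: for
--   Λ_n it is a symmetry of the n-cycle (a rotation or a reflection), for Γ
--   a symmetry of the path (identity or reversal).
-- * An edge of Λ_n flips some position p; the m positions not adjacent to p,
--   read cyclically from p, form a Fibonacci string.  Up to reversal this
--   string is a complete invariant of the edge orbit; likewise a vertex of Γ
--   up to reversal is a complete invariant of its orbit.  Hence both
--   o_E(Λ_{m+3}) and o_V(Γ_m) equal the number of Fibonacci strings of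
--   length m that are lexicographically ≤ their reversal.
-- * Burnside-style counting: twice that number is (all Fibonacci strings) +
--   (palindromic ones) = F (m + 2) + F (idx (m + 3)).
-- The cases n = 1, 2 are checked directly.

open import Defs
open import Data.Bool using (Bool; true; false; not; _∧_; if_then_else_)
open import Data.Bool.Properties using (not-involutive; ∧-comm; ∧-assoc; ∧-conicalˡ; ∧-conicalʳ; ∧-identityʳ; ∧-zeroʳ)
import Data.Bool.Properties as BoolP
open import Data.Nat using (ℕ; zero; suc; _+_; _*_; _∸_; _≤_; _<_; s≤s; z≤n; _%_; _/_; NonZero)
import Data.Nat.Properties as ℕP
open import Data.Nat.DivMod using (m%n<n; %-distribˡ-+; m%n%n≡m%n; m<n⇒m%n≡m; [m+n]%n≡m%n; n%n≡0; m/n≡1+[m∸n]/n)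
open import Data.Fin using (Fin; zero; suc; toℕ; punchOut; fromℕ<; fromℕ; inject₁; opposite; splitAt; join; _↑ˡ_; _↑ʳ_)
import Data.Fin.Properties as FinP
open FinP using (_≟_)
open import Data.Vec using (Vec; []; _∷_; lookup; tabulate; replicate; tail; last; init; initLast; _∷ʳ_; reverse)
import Data.Vec.Properties as VecP
open import Data.Product using (Σ; _×_; ∃; _,_; proj₁; proj₂)
open import Data.Sum using (_⊎_; inj₁; inj₂; [_,_]′)
open import Data.Empty using (⊥; ⊥-elim)
open import Relation.Nullary using (¬_; Dec; yes; no)
open import Relation.Binary.PropositionalEquality
open ≡-Reasoning
open import Axiom.UniquenessOfIdentityProofs using (module Decidable⇒UIP)
open import Algebra.Properties.CommutativeSemigroup ℕP.+-commutativeSemigroup using (interchange)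
import Data.Integer as ℤ
import Data.Integer.Properties as ℤP

t≢f : true ≢ false
t≢f ()

∧-l : ∀ {a b} → a ∧ b ≡ true → a ≡ true
∧-l {a} {b} = ∧-conicalˡ a b

∧-r : ∀ {a b} → a ∧ b ≡ true → b ≡ true
∧-r {a} {b} = ∧-conicalʳ a b

∧-i : ∀ {a b} → a ≡ true → b ≡ true → a ∧ b ≡ true
∧-i refl refl = refl

not-t : ∀ {a} → not a ≡ true → a ≡ false
not-t {false} _ = refl

t-not : ∀ {a} → a ≡ false → not a ≡ true
t-not refl = refl

¬true⇒false : ∀ {b} → ¬ (b ≡ true) → b ≡ false
¬true⇒false {true} h = ⊥-elim (h refl)
¬true⇒false {false} h = refl

bool-irr : ∀ {b : Bool} (p q : b ≡ true) → p ≡ q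
bool-irr = Decidable⇒UIP.≡-irrelevant BoolP._≟_

vec-ext : ∀ {A : Set} {n} {u v : Vec A n} → (∀ i → lookup u i ≡ lookup v i) → u ≡ v
vec-ext {u = u} {v} h = begin
  u                   ≡⟨ VecP.tabulate∘lookup u ⟨
  tabulate (lookup u) ≡⟨ VecP.tabulate-cong h ⟩
  tabulate (lookup v) ≡⟨ VecP.tabulate∘lookup v ⟩
  v                   ∎

inner-or-last : ∀ {n} (x : Fin (suc n)) → (Σ (Fin n) λ i → x ≡ inject₁ i) ⊎ (x ≡ fromℕ n)
inner-or-last {zero} zero = inj₂ refl
inner-or-last {suc n} zero = inj₁ (zero , refl)
inner-or-last {suc n} (suc x) with inner-or-last x
... | inj₁ (i , e) = inj₁ (suc i , cong suc e)
... | inj₂ e = inj₂ (cong suc e)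

flip : ∀ {n} → Fin n → Vec Bool n → Vec Bool n
flip zero (x ∷ xs) = not x ∷ xs
flip (suc i) (x ∷ xs) = x ∷ flip i xs

flip-same : ∀ {n} (p : Fin n) (u : Vec Bool n) → lookup (flip p u) p ≡ not (lookup u p)
flip-same zero (x ∷ u) = refl
flip-same (suc p) (x ∷ u) = flip-same p u

flip-other : ∀ {n} (p j : Fin n) (u : Vec Bool n) → p ≢ j → lookup (flip p u) j ≡ lookup u j
flip-other zero zero u ne = ⊥-elim (ne refl)
flip-other zero (suc j) (x ∷ u) ne = refl
flip-other (suc p) zero (x ∷ u) ne = refl
flip-other (suc p) (suc j) (x ∷ u) ne = flip-other p j u (λ e → ne (cong suc e))

flip-invol : ∀ {n} (p : Fin n) (u : Vec Bool n) → flip p (flip p u) ≡ u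
flip-invol zero (x ∷ u) = cong (_∷ u) (not-involutive x)
flip-invol (suc p) (x ∷ u) = cong (x ∷_) (flip-invol p u)

flip-back : ∀ {n} {x y : Vec Bool n} k → y ≡ flip k x → x ≡ flip k y
flip-back {x = x} k refl = sym (flip-invol k x)

unflip-same : ∀ {n} {x y : Vec Bool n} k → y ≡ flip k x → lookup x k ≡ not (lookup y k)
unflip-same k e = trans (cong (λ w → lookup w k) (flip-back k e)) (flip-same k _)

unflip-other : ∀ {n} {x y : Vec Bool n} k j → y ≡ flip k x → k ≢ j → lookup x j ≡ lookup y j
unflip-other k j e k≢j = trans (cong (λ w → lookup w j) (flip-back k e)) (flip-other k j _ k≢j)

flip-pos : ∀ {n} (p q : Fin n) (u : Vec Bool n) → flip p u ≡ flip q u → p ≡ q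
flip-pos p q u e with p ≟ q
... | yes p≡q = p≡q
... | no p≢q = ⊥-elim (not-fixed (lookup u p) (begin
  not (lookup u p)     ≡⟨ flip-same p u ⟨
  lookup (flip p u) p  ≡⟨ cong (λ w → lookup w p) e ⟩
  lookup (flip q u) p  ≡⟨ flip-other q p u (λ q≡p → p≢q (sym q≡p)) ⟩
  lookup u p           ∎))
  where
  not-fixed : ∀ b → not b ≢ b
  not-fixed true ()
  not-fixed false ()

flip-sub : ∀ {n} (u : Vec Bool n) i → lookup u i ≡ true → ∀ y → lookup (flip i u) y ≡ true → lookup u y ≡ true
flip-sub u i ui y h with i ≟ y
... | yes refl = ui
... | no ne = trans (sym (flip-other i y u ne)) h

ham-refl : ∀ {n} (u : Vec Bool n) → hamming u u ≡ 0
ham-refl [] = refl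
ham-refl (true ∷ u) = ham-refl u
ham-refl (false ∷ u) = ham-refl u

ham-sym : ∀ {n} (u v : Vec Bool n) → hamming u v ≡ hamming v u
ham-sym [] [] = refl
ham-sym (true ∷ u) (true ∷ v) = ham-sym u v
ham-sym (true ∷ u) (false ∷ v) = cong suc (ham-sym u v)
ham-sym (false ∷ u) (true ∷ v) = cong suc (ham-sym u v)
ham-sym (false ∷ u) (false ∷ v) = ham-sym u v

ham0 : ∀ {n} (u v : Vec Bool n) → hamming u v ≡ 0 → u ≡ v
ham0 [] [] h = refl
ham0 (true ∷ u) (true ∷ v) h = cong (true ∷_) (ham0 u v h)
ham0 (false ∷ u) (false ∷ v) h = cong (false ∷_) (ham0 u v h)

ham1 : ∀ {n} (u v : Vec Bool n) → hamming u v ≡ 1 → Σ (Fin n) λ p → v ≡ flip p u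
ham1 [] [] ()
ham1 (true ∷ u) (true ∷ v) h = let (p , e) = ham1 u v h in suc p , cong (true ∷_) e
ham1 (false ∷ u) (false ∷ v) h = let (p , e) = ham1 u v h in suc p , cong (false ∷_) e
ham1 (true ∷ u) (false ∷ v) h = zero , cong (false ∷_) (sym (ham0 u v (ℕP.suc-injective h)))
ham1 (false ∷ u) (true ∷ v) h = zero , cong (true ∷_) (sym (ham0 u v (ℕP.suc-injective h)))

ham-flip : ∀ {n} (p : Fin n) (u : Vec Bool n) → hamming u (flip p u) ≡ 1
ham-flip zero (true ∷ u) = cong suc (ham-refl u)
ham-flip zero (false ∷ u) = cong suc (ham-refl u)
ham-flip (suc p) (true ∷ u) = ham-flip p u
ham-flip (suc p) (false ∷ u) = ham-flip p u

zeroV : ∀ {n} → Vec Bool n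
zeroV {n} = replicate n false

lookup-zeroV : ∀ {n} (i : Fin n) → lookup (zeroV {n}) i ≡ false
lookup-zeroV {suc n} zero = refl
lookup-zeroV {suc n} (suc i) = lookup-zeroV i

unit-support : ∀ {n} (i y : Fin n) → lookup (flip i zeroV) y ≡ true → y ≡ i
unit-support i y h with i ≟ y
... | yes e = sym e
... | no ne = ⊥-elim (t≢f (trans (sym h) (trans (flip-other i y zeroV ne) (lookup-zeroV y))))

unit-at : ∀ {n} (i : Fin n) → lookup (flip i zeroV) i ≡ true
unit-at i = trans (flip-same i zeroV) (cong not (lookup-zeroV i))

pair : ∀ {n} → Fin n → Fin n → Vec Bool n
pair a b = flip a (flip b zeroV)

pair-support : ∀ {n} (a b y : Fin n) → lookup (pair a b) y ≡ true → (y ≡ a) ⊎ (y ≡ b)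
pair-support a b y h with a ≟ y
... | yes e = inj₁ (sym e)
... | no ne = inj₂ (unit-support b y (trans (sym (flip-other a y _ ne)) h))

pair-at₁ : ∀ {n} (a b : Fin n) → a ≢ b → lookup (pair a b) a ≡ true
pair-at₁ a b ne = trans (flip-same a _) (cong not (trans (flip-other b a zeroV (λ e → ne (sym e))) (lookup-zeroV a)))

pair-at₂ : ∀ {n} (a b : Fin n) → a ≢ b → lookup (pair a b) b ≡ true
pair-at₂ a b ne = trans (flip-other a b _ ne) (unit-at b)

-- Weight (number of ones), used as induction measure in the rigidity proof.

weight : ∀ {n} → Vec Bool n → ℕ
weight [] = 0
weight (true ∷ u) = suc (weight u)
weight (false ∷ u) = weight u

weight-flip : ∀ {n} (i : Fin n) (u : Vec Bool n) → lookup u i ≡ true → suc (weight (flip i u)) ≡ weight u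
weight-flip zero (true ∷ u) e = refl
weight-flip (suc i) (true ∷ u) e = cong suc (weight-flip i u e)
weight-flip (suc i) (false ∷ u) e = weight-flip i u e

one-or-zero : ∀ {n} (u : Vec Bool n) → (Σ (Fin n) λ i → lookup u i ≡ true) ⊎ (u ≡ zeroV)
one-or-zero [] = inj₂ refl
one-or-zero (true ∷ u) = inj₁ (zero , refl)
one-or-zero (false ∷ u) with one-or-zero u
... | inj₁ (i , e) = inj₁ (suc i , e)
... | inj₂ e = inj₂ (cong (false ∷_) e)

injective-hits : ∀ {n} (p : Fin n) (d : Fin n → Fin n) → (∀ j → d j ≢ p) → (∀ i j → d i ≡ d j → i ≡ j) → ⊥
injective-hits {suc n'} p d ne inj with FinP.pigeonhole (ℕP.n<1+n n') (λ j → punchOut {i = p} (λ q → ne j (sym q)))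
... | i , j , i<j , e = FinP.<⇒≢ i<j (inj i j (FinP.punchOut-injective {i = p} (λ q → ne i (sym q)) (λ q → ne j (sym q)) e))

invert : ∀ {n} (f : Fin n → Fin n) → (∀ {x y} → f x ≡ f y → x ≡ y) →
         Σ (Fin n → Fin n) λ g → (∀ y → f (g y) ≡ y) × (∀ x → g (f x) ≡ x)
invert {n} f inj = g , fg , λ x → inj (fg (f x))
  where
  preimage : ∀ y → Σ (Fin n) λ x → f x ≡ y
  preimage y with FinP.any? (λ x → f x ≟ y)
  ... | yes r = r
  ... | no r = ⊥-elim (injective-hits y f (λ j q → r (j , q)) (λ i j q → inj q))
  g : Fin n → Fin n
  g y = proj₁ (preimage y)
  fg : ∀ y → f (g y) ≡ y
  fg y = proj₂ (preimage y)

-- Permuting coordinates: (permute τ u) y = u (τ y).  A bijection of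
-- coordinates turns flips into flips, hence preserves hypercube adjacency.

permute : ∀ {n} → (Fin n → Fin n) → Vec Bool n → Vec Bool n
permute τ u = tabulate (λ y → lookup u (τ y))

lookup-permute : ∀ {n} (τ : Fin n → Fin n) (u : Vec Bool n) y → lookup (permute τ u) y ≡ lookup u (τ y)
lookup-permute τ u y = VecP.lookup∘tabulate (λ y → lookup u (τ y)) y

permute-flip : ∀ {n} (σ τ : Fin n → Fin n) → (∀ x → τ (σ x) ≡ x) → (∀ y → σ (τ y) ≡ y) →
               ∀ p u → permute τ (flip p u) ≡ flip (σ p) (permute τ u)
permute-flip σ τ τσ στ p u = vec-ext at
  where
  at : ∀ y → lookup (permute τ (flip p u)) y ≡ lookup (flip (σ p) (permute τ u)) y
  at y with σ p ≟ y
  ... | yes refl = begin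
    lookup (permute τ (flip p u)) (σ p)  ≡⟨ lookup-permute τ (flip p u) (σ p) ⟩
    lookup (flip p u) (τ (σ p))          ≡⟨ cong (lookup (flip p u)) (τσ p) ⟩
    lookup (flip p u) p                  ≡⟨ flip-same p u ⟩
    not (lookup u p)                     ≡⟨ cong (λ w → not (lookup u w)) (τσ p) ⟨
    not (lookup u (τ (σ p)))             ≡⟨ cong not (lookup-permute τ u (σ p)) ⟨
    not (lookup (permute τ u) (σ p))     ≡⟨ flip-same (σ p) (permute τ u) ⟨
    lookup (flip (σ p) (permute τ u)) (σ p) ∎
  ... | no ne = begin
    lookup (permute τ (flip p u)) y  ≡⟨ lookup-permute τ (flip p u) y ⟩
    lookup (flip p u) (τ y)          ≡⟨ flip-other p (τ y) u (λ q → ne (trans (cong σ q) (στ y))) ⟩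
    lookup u (τ y)                   ≡⟨ lookup-permute τ u y ⟨
    lookup (permute τ u) y           ≡⟨ flip-other (σ p) y (permute τ u) ne ⟨
    lookup (flip (σ p) (permute τ u)) y ∎

permute-inverse : ∀ {n} (σ τ : Fin n → Fin n) → (∀ y → τ (σ y) ≡ y) → ∀ u → permute σ (permute τ u) ≡ u
permute-inverse σ τ τσ u = vec-ext λ y →
  trans (lookup-permute σ (permute τ u) y) (trans (lookup-permute τ u (σ y)) (cong (lookup u) (τσ y)))

permute-adj : ∀ {n} (σ τ : Fin n → Fin n) → (∀ x → τ (σ x) ≡ x) → (∀ y → σ (τ y) ≡ y) →
              ∀ (u v : Vec Bool n) → hamming u v ≡ 1 → hamming (permute τ u) (permute τ v) ≡ 1
permute-adj σ τ τσ στ u v h with ham1 u v h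
... | p , refl = subst (λ w → hamming (permute τ u) w ≡ 1) (sym (permute-flip σ τ τσ στ p u)) (ham-flip (σ p) (permute τ u))

vertex-≡ : ∀ {n} {P : Vec Bool n → Bool} (u v : Graph.V (induced n P)) → proj₁ u ≡ proj₁ v → u ≡ v
vertex-≡ (x , p) (.x , q) refl = cong (x ,_) (bool-irr p q)

idAut : ∀ {G} → Aut G
idAut = record { to = λ u → u ; from = λ u → u ; to-from = λ _ → refl ; from-to = λ _ → refl
               ; adj⇒ = λ _ _ a → a ; adj⇐ = λ _ _ a → a }

module PermAut {n : ℕ} (P : Vec Bool n → Bool) (σ τ : Fin n → Fin n)
  (τσ : ∀ x → τ (σ x) ≡ x) (στ : ∀ y → σ (τ y) ≡ y)
  (Pτ : ∀ u → P u ≡ true → P (permute τ u) ≡ true)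
  (Pσ : ∀ u → P u ≡ true → P (permute σ u) ≡ true) where

  aut : Aut (induced n P)
  aut = record
    { to = λ u → permute τ (proj₁ u) , Pτ (proj₁ u) (proj₂ u)
    ; from = λ u → permute σ (proj₁ u) , Pσ (proj₁ u) (proj₂ u)
    ; to-from = λ u → vertex-≡ _ _ (permute-inverse τ σ στ (proj₁ u))
    ; from-to = λ u → vertex-≡ _ _ (permute-inverse σ τ τσ (proj₁ u))
    ; adj⇒ = λ u v → permute-adj σ τ τσ στ (proj₁ u) (proj₁ v)
    ; adj⇐ = λ u v h → subst₂ (λ a b → hamming a b ≡ 1)
                         (permute-inverse σ τ τσ (proj₁ u)) (permute-inverse σ τ τσ (proj₁ v))
                         (permute-adj τ σ στ τσ (permute τ (proj₁ u)) (permute τ (proj₁ v)) h) }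

module Rigid {n : ℕ} (P : Vec Bool n → Bool)
  (P-zero : P zeroV ≡ true)
  (P-unit : ∀ i → P (flip i zeroV) ≡ true)
  (P-down : ∀ u i → P u ≡ true → lookup u i ≡ true → P (flip i u) ≡ true)
  (P-blocked : ∀ c t → P c ≡ true → lookup c t ≡ true → Σ (Fin n) λ p → P (flip p c) ≡ false)
  where

  G : Graph
  G = induced n P

  V : Set
  V = Graph.V G

  z : V
  z = zeroV , P-zero

  e : Fin n → V
  e i = flip i zeroV , P-unit i

  inv : Aut G → Aut G
  inv φ = record
    { to = from ; from = to ; to-from = from-to ; from-to = to-from
    ; adj⇒ = λ u v a → adj⇐ (from u) (from v) (subst₂ (Graph.Adj G) (sym (to-from u)) (sym (to-from v)) a)
    ; adj⇐ = λ u v a → subst₂ (Graph.Adj G) (to-from u) (to-from v) (adj⇒ (from u) (from v) a) }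
    where open Aut φ

  to-inj : (φ : Aut G) → ∀ {u v} → Aut.to φ u ≡ Aut.to φ v → u ≡ v
  to-inj φ {u} {v} h = trans (sym (Aut.from-to φ u)) (trans (cong (Aut.from φ) h) (Aut.from-to φ v))

  image-neighbour : (φ : Aut G) (x y : V) (p : Fin n) → proj₁ y ≡ flip p (proj₁ x) →
                    Σ (Fin n) λ q → proj₁ (Aut.to φ y) ≡ flip q (proj₁ (Aut.to φ x))
  image-neighbour φ x y p h =
    ham1 _ _ (Aut.adj⇒ φ x y (subst (λ w → hamming (proj₁ x) w ≡ 1) (sym h) (ham-flip p (proj₁ x))))

  -- φ fixes 0: the n distinct neighbours e_j of 0 go to n distinct flips
  -- of φ 0 inside P, but a nonzero φ 0 has a flip outside P.
  fixes-zero : (φ : Aut G) → Aut.to φ z ≡ z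
  fixes-zero φ with one-or-zero (proj₁ (Aut.to φ z))
  ... | inj₂ h = vertex-≡ _ _ h
  ... | inj₁ (t , ct) = ⊥-elim (injective-hits p d d≢p d-inj)
    where
    c = proj₁ (Aut.to φ z)
    blocked = P-blocked c t (proj₂ (Aut.to φ z)) ct
    p = proj₁ blocked
    d : Fin n → Fin n
    d j = proj₁ (image-neighbour φ z (e j) j refl)
    d-spec : ∀ j → proj₁ (Aut.to φ (e j)) ≡ flip (d j) c
    d-spec j = proj₂ (image-neighbour φ z (e j) j refl)
    d≢p : ∀ j → d j ≢ p
    d≢p j dj≡p = t≢f (begin
      true                          ≡⟨ proj₂ (Aut.to φ (e j)) ⟨
      P (proj₁ (Aut.to φ (e j)))    ≡⟨ cong P (d-spec j) ⟩
      P (flip (d j) c)              ≡⟨ cong (λ r → P (flip r c)) dj≡p ⟩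
      P (flip p c)                  ≡⟨ proj₂ blocked ⟩
      false                         ∎)
    d-inj : ∀ i j → d i ≡ d j → i ≡ j
    d-inj i j h = flip-pos i j zeroV (cong proj₁ (to-inj φ (vertex-≡ _ _
      (trans (d-spec i) (trans (cong (λ r → flip r c) h) (sym (d-spec j)))))))

  -- The coordinate permutation π of φ, defined by φ e_i = e_{π i}.
  perm : Aut G → Fin n → Fin n
  perm φ i = proj₁ (image-neighbour φ z (e i) i refl)

  perm-spec : (φ : Aut G) → ∀ i → Aut.to φ (e i) ≡ e (perm φ i)
  perm-spec φ i = vertex-≡ _ _ (trans (proj₂ (image-neighbour φ z (e i) i refl))
                                     (cong (λ w → flip (perm φ i) (proj₁ w)) (fixes-zero φ)))

  perm-inj : (φ : Aut G) → ∀ {i j} → perm φ i ≡ perm φ j → i ≡ j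
  perm-inj φ {i} {j} h = flip-pos i j zeroV (cong proj₁ (to-inj φ
    (trans (perm-spec φ i) (trans (cong e h) (sym (perm-spec φ j))))))

  perm-compose : (φ ψ : Aut G) → (∀ v → Aut.to ψ (Aut.to φ v) ≡ v) → ∀ i → perm ψ (perm φ i) ≡ i
  perm-compose φ ψ h i = flip-pos _ _ zeroV (cong proj₁ (begin
    e (perm ψ (perm φ i))       ≡⟨ perm-spec ψ (perm φ i) ⟨
    Aut.to ψ (e (perm φ i))     ≡⟨ cong (Aut.to ψ) (perm-spec φ i) ⟨
    Aut.to ψ (Aut.to φ (e i))   ≡⟨ h (e i) ⟩
    e i                         ∎))

  perm-section : (φ : Aut G) → ∀ y → perm φ (perm (inv φ) y) ≡ y
  perm-section φ = perm-compose (inv φ) φ (Aut.to-from φ)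

  perm-retraction : (φ : Aut G) → ∀ x → perm (inv φ) (perm φ x) ≡ x
  perm-retraction φ = perm-compose φ (inv φ) (Aut.from-to φ)

  Acts : Aut G → V → Set
  Acts φ u = ∀ j → lookup (proj₁ (Aut.to φ u)) (perm φ j) ≡ lookup (proj₁ u) j

  acts-determines : (φ : Aut G) (x : V) → Acts φ x → ∀ {W} →
                    (∀ j → lookup W (perm φ j) ≡ lookup (proj₁ x) j) → W ≡ proj₁ (Aut.to φ x)
  acts-determines φ x Ax {W} h = vec-ext λ y → begin
    lookup W y                                 ≡⟨ cong (lookup W) (perm-section φ y) ⟨
    lookup W (perm φ (perm (inv φ) y))         ≡⟨ h (perm (inv φ) y) ⟩
    lookup (proj₁ x) (perm (inv φ) y)          ≡⟨ Ax (perm (inv φ) y) ⟨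
    lookup (proj₁ (Aut.to φ x)) (perm φ (perm (inv φ) y)) ≡⟨ cong (lookup (proj₁ (Aut.to φ x))) (perm-section φ y) ⟩
    lookup (proj₁ (Aut.to φ x)) y              ∎

  reads-flip-other : (φ : Aut G) (x : V) → Acts φ x → ∀ {W q j} →
                     W ≡ flip q (proj₁ (Aut.to φ x)) → q ≢ perm φ j → lookup W (perm φ j) ≡ lookup (proj₁ x) j
  reads-flip-other φ x Ax {q = q} {j} refl q≢ = trans (flip-other q (perm φ j) _ q≢) (Ax j)

  reads-flip-same : (φ : Aut G) (x : V) → Acts φ x → ∀ {W} k →
                    W ≡ flip (perm φ k) (proj₁ (Aut.to φ x)) →
                    ∀ j → lookup W (perm φ j) ≡ lookup (flip k (proj₁ x)) j
  reads-flip-same φ x Ax k refl j with k ≟ j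
  ... | yes refl = trans (flip-same (perm φ k) _) (trans (cong not (Ax k)) (sym (flip-same k (proj₁ x))))
  ... | no k≢j = trans (reads-flip-other φ x Ax refl (λ e → k≢j (perm-inj φ e))) (sym (flip-other k j (proj₁ x) k≢j))

  acts-zero : (φ : Aut G) → Acts φ z
  acts-zero φ j = trans (cong (λ w → lookup (proj₁ w) (perm φ j)) (fixes-zero φ))
                        (trans (lookup-zeroV (perm φ j)) (sym (lookup-zeroV j)))

  acts-unit : (φ : Aut G) → ∀ i → Acts φ (e i)
  acts-unit φ i = reads-flip-same φ z (acts-zero φ) i
    (trans (cong proj₁ (perm-spec φ i)) (cong (λ w → flip (perm φ i) (proj₁ w)) (sym (fixes-zero φ))))

  -- Let u have ones at i ≠ i', with
  -- a = u - e_i, b = u - e_i' and c = a - e_i', and let φ act on a, b, c.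
  -- If φ u were a flip of φ a at some q ≠ π i, reading φ u at π i and π i'
  -- would force q = π i', making φ u = φ c, i.e. u = c, although u i = 1.
  flip-direction : (φ : Aut G) (u a b c : V) (i i' : Fin n) → i ≢ i' →
    lookup (proj₁ u) i ≡ true → lookup (proj₁ u) i' ≡ true →
    proj₁ u ≡ flip i (proj₁ a) → proj₁ u ≡ flip i' (proj₁ b) → proj₁ a ≡ flip i' (proj₁ c) →
    Acts φ a → Acts φ b → Acts φ c →
    ∀ q → proj₁ (Aut.to φ u) ≡ flip q (proj₁ (Aut.to φ a)) → q ≡ perm φ i
  flip-direction φ u a b c i i' i≢i' ui ui' ua ub ac Aa Ab Ac q Uq with q ≟ perm φ i
  ... | yes q≡πi = q≡πi
  ... | no q≢πi = ⊥-elim (t≢f (trans (sym ui) (trans (cong (λ w → lookup w i) u≡c) c-i)))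
    where
    π = perm φ
    i'≢i : i' ≢ i
    i'≢i e = i≢i' (sym e)
    a-i = trans (unflip-same i ua) (cong not ui)
    a-i' = trans (unflip-other i i' ua i≢i') ui'
    b-i = trans (unflip-other i' i ub i'≢i) ui
    b-i' = trans (unflip-same i' ub) (cong not ui')
    c-i = trans (unflip-other i' i ac i'≢i) a-i
    q' = proj₁ (image-neighbour φ b u i' ub)
    Uq' : proj₁ (Aut.to φ u) ≡ flip q' (proj₁ (Aut.to φ b))
    Uq' = proj₂ (image-neighbour φ b u i' ub)
    -- φ u is 0 at π i (as φ a is), so as a flip of φ b it flips π i
    q'≡πi : q' ≡ π i
    q'≡πi with q' ≟ π i
    ... | yes e = e
    ... | no q'≢πi = ⊥-elim (t≢f (trans (sym b-i) (trans (sym (reads-flip-other φ b Ab Uq' q'≢πi))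
                                              (trans (reads-flip-other φ a Aa Uq q≢πi) a-i))))
    -- hence φ u is 0 at π i' (as φ b is), so as a flip of φ a it flips π i'
    q≡πi' : q ≡ π i'
    q≡πi' with q ≟ π i'
    ... | yes e = e
    ... | no q≢πi' = ⊥-elim (t≢f (trans (sym a-i') (trans (sym (reads-flip-other φ a Aa Uq q≢πi'))
                   (trans (reads-flip-other φ b Ab (trans Uq' (cong (λ r → flip r _) q'≡πi)) (λ e → i≢i' (perm-inj φ e))) b-i'))))
    u≡c : proj₁ u ≡ proj₁ c
    u≡c = cong proj₁ (to-inj φ (vertex-≡ _ _ (acts-determines φ c Ac λ j →
      trans (reads-flip-same φ a Aa i' (trans Uq (cong (λ r → flip r _) q≡πi')) j)
            (cong (λ w → lookup w j) (sym (flip-back i' ac))))))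

  acts-two-ones : (φ : Aut G) (u a b c : V) (i i' : Fin n) → i ≢ i' →
    lookup (proj₁ u) i ≡ true → lookup (proj₁ u) i' ≡ true →
    proj₁ u ≡ flip i (proj₁ a) → proj₁ u ≡ flip i' (proj₁ b) → proj₁ a ≡ flip i' (proj₁ c) →
    Acts φ a → Acts φ b → Acts φ c → Acts φ u
  acts-two-ones φ u a b c i i' i≢i' ui ui' ua ub ac Aa Ab Ac j = trans
    (reads-flip-same φ a Aa i (trans Uq (cong (λ r → flip r _) (flip-direction φ u a b c i i' i≢i' ui ui' ua ub ac Aa Ab Ac q Uq))) j)
    (cong (λ w → lookup w j) (sym ua))
    where
    q = proj₁ (image-neighbour φ a u i ua)
    Uq = proj₂ (image-neighbour φ a u i ua)

  drop : (u : V) (i : Fin n) → lookup (proj₁ u) i ≡ true → V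
  drop u i ui = flip i (proj₁ u) , P-down (proj₁ u) i (proj₂ u) ui

  undrop : ∀ u i ui → proj₁ u ≡ flip i (proj₁ (drop u i ui))
  undrop u i ui = sym (flip-invol i (proj₁ u))

  lighter : ∀ {k} u i ui → weight (proj₁ u) ≤ k → suc (weight (proj₁ (drop u i ui))) ≤ k
  lighter u i ui = subst (_≤ _) (sym (weight-flip i (proj₁ u) ui))

  mutual
    acts-weight : (φ : Aut G) → ∀ k (u : V) → weight (proj₁ u) ≤ k → Acts φ u
    acts-weight φ k u w with one-or-zero (proj₁ u)
    ... | inj₂ u≡0 = subst (Acts φ) (sym (vertex-≡ u z u≡0)) (acts-zero φ)
    ... | inj₁ (i , ui) = acts-nonzero φ k u i ui (lighter u i ui w)

    acts-nonzero : (φ : Aut G) → ∀ k (u : V) i (ui : lookup (proj₁ u) i ≡ true) →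
                   suc (weight (proj₁ (drop u i ui))) ≤ k → Acts φ u
    acts-nonzero φ (suc k) u i ui (s≤s w) with one-or-zero (flip i (proj₁ u))
    ... | inj₂ a≡0 = subst (Acts φ) (sym (vertex-≡ u (e i) (trans (undrop u i ui) (cong (flip i) a≡0)))) (acts-unit φ i)
    ... | inj₁ (i' , ai') =
      acts-two-ones φ u a b c i i' i≢i' ui ui' (undrop u i ui) (undrop u i' ui') (undrop a i' ai')
        (acts-weight φ k a w)
        (acts-weight φ k b (ℕP.≤-pred (lighter u i' ui' (subst (_≤ suc k) (weight-flip i (proj₁ u) ui) (s≤s w)))))
        (acts-weight φ k c (ℕP.<⇒≤ (lighter a i' ai' w)))
      where
      a = drop u i ui
      i≢i' : i ≢ i'
      i≢i' refl = t≢f (trans (sym ai') (trans (flip-same i _) (cong not ui)))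
      ui' : lookup (proj₁ u) i' ≡ true
      ui' = trans (sym (flip-other i i' _ i≢i')) ai'
      b = drop u i' ui'
      c = drop a i' ai'

  act : (φ : Aut G) (u : V) → Acts φ u
  act φ u = acts-weight φ (weight (proj₁ u)) u ℕP.≤-refl

  flip-image : (φ : Aut G) (u v : V) (p : Fin n) → proj₁ v ≡ flip p (proj₁ u) →
               proj₁ (Aut.to φ v) ≡ flip (perm φ p) (proj₁ (Aut.to φ u))
  flip-image φ u v p v≡ = sym (acts-determines φ v (act φ v) λ j →
    trans (reads-flip-same φ u (act φ u) p refl j) (cong (λ w → lookup w j) (sym v≡)))

  Transports : Aut G → (Fin n → Fin n) → Set
  Transports φ σ = ∀ w j → lookup (proj₁ (Aut.to φ w)) (σ j) ≡ lookup (proj₁ w) j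

  transports-perm : (φ : Aut G) (σ : Fin n → Fin n) → Transports φ σ → ∀ i → perm φ i ≡ σ i
  transports-perm φ σ t i = sym (unit-support (perm φ i) (σ i)
    (trans (cong (λ w → lookup (proj₁ w) (σ i)) (sym (perm-spec φ i))) (trans (t (e i) i) (unit-at i))))

  pair-pullback : (φ : Aut G) → ∀ i j → i ≢ j → P (pair (perm φ i) (perm φ j)) ≡ true →
                  Σ V λ w → lookup (proj₁ w) i ≡ true × lookup (proj₁ w) j ≡ true
  pair-pullback φ i j i≢j h = Aut.to ψ W , at i (pair-at₁ _ _ π≢) , at j (pair-at₂ _ _ π≢)
    where
    ψ = inv φ
    W : V
    W = pair (perm φ i) (perm φ j) , h
    π≢ : perm φ i ≢ perm φ j
    π≢ e = i≢j (perm-inj φ e)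
    at : ∀ k → lookup (proj₁ W) (perm φ k) ≡ true → lookup (proj₁ (Aut.to ψ W)) k ≡ true
    at k h = trans (cong (lookup (proj₁ (Aut.to ψ W))) (sym (perm-retraction φ k))) (trans (act ψ W (perm φ k)) h)

lookup-∷ʳ-last : ∀ {A : Set} {m} (s : Vec A m) x → lookup (s ∷ʳ x) (fromℕ m) ≡ x
lookup-∷ʳ-last [] x = refl
lookup-∷ʳ-last (y ∷ s) x = lookup-∷ʳ-last s x

lookup-∷ʳ-inject₁ : ∀ {A : Set} {m} (s : Vec A m) x (k : Fin m) → lookup (s ∷ʳ x) (inject₁ k) ≡ lookup s k
lookup-∷ʳ-inject₁ (y ∷ s) x zero = refl
lookup-∷ʳ-inject₁ (y ∷ s) x (suc k) = lookup-∷ʳ-inject₁ s x k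

opposite-fromℕ : ∀ m → opposite (fromℕ m) ≡ zero
opposite-fromℕ m = FinP.toℕ-injective (begin
  toℕ (opposite (fromℕ m))  ≡⟨ FinP.opposite-prop (fromℕ m) ⟩
  m ∸ toℕ (fromℕ m)         ≡⟨ cong (m ∸_) (FinP.toℕ-fromℕ m) ⟩
  m ∸ m                     ≡⟨ ℕP.n∸n≡0 m ⟩
  0                         ∎)

opposite-inject₁ : ∀ {m} (k : Fin m) → opposite (inject₁ k) ≡ suc (opposite k)
opposite-inject₁ {m} k = FinP.toℕ-injective (begin
  toℕ (opposite (inject₁ k))  ≡⟨ FinP.opposite-prop (inject₁ k) ⟩
  suc m ∸ suc (toℕ (inject₁ k)) ≡⟨ cong (λ w → suc m ∸ suc w) (FinP.toℕ-inject₁ k) ⟩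
  suc m ∸ suc (toℕ k)         ≡⟨ ℕP.+-∸-assoc 1 (FinP.toℕ<n k) ⟩
  suc (m ∸ suc (toℕ k))       ≡⟨ cong suc (FinP.opposite-prop k) ⟨
  suc (toℕ (opposite k))      ∎)

lookup-reverse : ∀ {A : Set} {m} (s : Vec A m) k → lookup (reverse s) k ≡ lookup s (opposite k)
lookup-reverse (x ∷ s) k with inner-or-last k
... | inj₁ (j , refl) = begin
  lookup (reverse (x ∷ s)) (inject₁ j)   ≡⟨ cong (λ w → lookup w (inject₁ j)) (VecP.reverse-∷ x s) ⟩
  lookup (reverse s ∷ʳ x) (inject₁ j)    ≡⟨ lookup-∷ʳ-inject₁ (reverse s) x j ⟩
  lookup (reverse s) j                   ≡⟨ lookup-reverse s j ⟩
  lookup s (opposite j)                  ≡⟨ cong (lookup (x ∷ s)) (opposite-inject₁ j) ⟨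
  lookup (x ∷ s) (opposite (inject₁ j))  ∎
... | inj₂ refl = begin
  lookup (reverse (x ∷ s)) (fromℕ _)     ≡⟨ cong (λ w → lookup w (fromℕ _)) (VecP.reverse-∷ x s) ⟩
  lookup (reverse s ∷ʳ x) (fromℕ _)      ≡⟨ lookup-∷ʳ-last (reverse s) x ⟩
  x                                      ≡⟨ cong (lookup (x ∷ s)) (opposite-fromℕ _) ⟨
  lookup (x ∷ s) (opposite (fromℕ _))    ∎

reverse-∷ʳ : ∀ {A : Set} {m} (s : Vec A m) x → reverse (s ∷ʳ x) ≡ x ∷ reverse s
reverse-∷ʳ s x = begin
  reverse (s ∷ʳ x)                        ≡⟨ cong (λ w → reverse (w ∷ʳ x)) (VecP.reverse-involutive s) ⟨
  reverse (reverse (reverse s) ∷ʳ x)      ≡⟨ cong reverse (VecP.reverse-∷ x (reverse s)) ⟨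
  reverse (reverse (x ∷ reverse s))       ≡⟨ VecP.reverse-involutive (x ∷ reverse s) ⟩
  x ∷ reverse s                           ∎

Consecutive : ∀ {M} → Fin M → Fin M → Set
Consecutive a b = toℕ b ≡ suc (toℕ a)

FibAt : ∀ {m} → Vec Bool m → Set
FibAt {m} u = ∀ (i j : Fin m) → Consecutive i j → lookup u i ∧ lookup u j ≡ false

noCons⇒FibAt : ∀ {m} (u : Vec Bool m) → noCons u ≡ true → FibAt u
noCons⇒FibAt (x ∷ y ∷ u) h zero (suc zero) _ = not-t (∧-l h)
noCons⇒FibAt (x ∷ y ∷ u) h (suc i) (suc j) e = noCons⇒FibAt (y ∷ u) (∧-r {not (x ∧ y)} h) i j (ℕP.suc-injective e)

FibAt⇒noCons : ∀ {m} (u : Vec Bool m) → FibAt u → noCons u ≡ true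
FibAt⇒noCons [] h = refl
FibAt⇒noCons (x ∷ []) h = refl
FibAt⇒noCons (x ∷ y ∷ u) h = ∧-i (t-not (h zero (suc zero) refl)) (FibAt⇒noCons (y ∷ u) λ i j e → h (suc i) (suc j) (cong suc e))

opposite-consecutive : ∀ {M} {i j : Fin M} → Consecutive i j → Consecutive (opposite j) (opposite i)
opposite-consecutive {M} {i} {j} e = begin
  toℕ (opposite i)          ≡⟨ FinP.opposite-prop i ⟩
  M ∸ suc (toℕ i)           ≡⟨ cong (M ∸_) e ⟨
  M ∸ toℕ j                 ≡⟨ ℕP.+-∸-assoc 1 (FinP.toℕ<n j) ⟩
  suc (M ∸ suc (toℕ j))     ≡⟨ cong suc (FinP.opposite-prop j) ⟨
  suc (toℕ (opposite j))    ∎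

noCons-reverse : ∀ {m} (u : Vec Bool m) → noCons u ≡ true → noCons (reverse u) ≡ true
noCons-reverse u h = FibAt⇒noCons (reverse u) λ i j e → begin
  lookup (reverse u) i ∧ lookup (reverse u) j     ≡⟨ cong₂ _∧_ (lookup-reverse u i) (lookup-reverse u j) ⟩
  lookup u (opposite i) ∧ lookup u (opposite j)   ≡⟨ ∧-comm (lookup u (opposite i)) _ ⟩
  lookup u (opposite j) ∧ lookup u (opposite i)   ≡⟨ noCons⇒FibAt u h _ _ (opposite-consecutive e) ⟩
  false                                           ∎

noCons-reverse-≡ : ∀ {m} (u : Vec Bool m) → noCons (reverse u) ≡ noCons u
noCons-reverse-≡ u with noCons u in e1 | noCons (reverse u) in e2
... | true | true = refl
... | false | false = refl
... | true | false = trans (sym e2) (noCons-reverse u e1)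
... | false | true = trans (sym (noCons-reverse (reverse u) e2)) (trans (cong noCons (VecP.reverse-involutive u)) e1)

lexLe : ∀ {m} → Vec Bool m → Vec Bool m → Bool
lexLe [] [] = true
lexLe (false ∷ s) (true ∷ t) = true
lexLe (true ∷ s) (false ∷ t) = false
lexLe (false ∷ s) (false ∷ t) = lexLe s t
lexLe (true ∷ s) (true ∷ t) = lexLe s t

lex-total : ∀ {m} (s t : Vec Bool m) → lexLe s t ≡ false → lexLe t s ≡ true
lex-total [] [] ()
lex-total (false ∷ s) (false ∷ t) h = lex-total s t h
lex-total (true ∷ s) (true ∷ t) h = lex-total s t h
lex-total (true ∷ s) (false ∷ t) h = refl

lex-antisym : ∀ {m} (s t : Vec Bool m) → lexLe s t ≡ true → lexLe t s ≡ true → s ≡ t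
lex-antisym [] [] _ _ = refl
lex-antisym (false ∷ s) (false ∷ t) a b = cong (false ∷_) (lex-antisym s t a b)
lex-antisym (true ∷ s) (true ∷ t) a b = cong (true ∷_) (lex-antisym s t a b)

canon : ∀ {m} → Vec Bool m → Vec Bool m
canon s = if lexLe s (reverse s) then s else reverse s

Can : ∀ {m} → Vec Bool m → Bool
Can s = noCons s ∧ lexLe s (reverse s)

canon-reverse : ∀ {m} (s : Vec Bool m) → canon (reverse s) ≡ canon s
canon-reverse s with lexLe s (reverse s) in e1 | lexLe (reverse s) (reverse (reverse s)) in e2
... | true | true = sym (lex-antisym s (reverse s) e1 (subst (λ w → lexLe (reverse s) w ≡ true) (VecP.reverse-involutive s) e2))
... | true | false = VecP.reverse-involutive s
... | false | true = refl
... | false | false = ⊥-elim (t≢f (trans (sym (lex-total s (reverse s) e1))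
                                  (trans (cong (lexLe (reverse s)) (sym (VecP.reverse-involutive s))) e2)))

canon-cases : ∀ {m} (s : Vec Bool m) → (canon s ≡ s) ⊎ (canon s ≡ reverse s)
canon-cases s with lexLe s (reverse s)
... | true = inj₁ refl
... | false = inj₂ refl

canon-Can : ∀ {m} (s : Vec Bool m) → noCons s ≡ true → Can (canon s) ≡ true
canon-Can s h with lexLe s (reverse s) in e
... | true = ∧-i h e
... | false = ∧-i (noCons-reverse s h) (trans (cong (lexLe (reverse s)) (VecP.reverse-involutive s)) (lex-total s (reverse s) e))

canon-fix : ∀ {m} (c : Vec Bool m) → Can c ≡ true → canon c ≡ c
canon-fix c h rewrite ∧-r {noCons c} h = refl

b2n : Bool → ℕ
b2n true = 1
b2n false = 0

card : ∀ {m} → (Vec Bool m → Bool) → ℕ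
card {zero} P = b2n (P [])
card {suc m} P = card (λ s → P (false ∷ s)) + card (λ s → P (true ∷ s))

enum : ∀ {m} (P : Vec Bool m → Bool) → Fin (card P) → Vec Bool m
enum {zero} P i = []
enum {suc m} P i = [ (λ a → false ∷ enum (λ s → P (false ∷ s)) a) , (λ b → true ∷ enum (λ s → P (true ∷ s)) b) ]′
                     (splitAt (card (λ s → P (false ∷ s))) i)

enum-P : ∀ {m} (P : Vec Bool m → Bool) i → P (enum P i) ≡ true
enum-P {zero} P i with P []
enum-P {zero} P zero | true = refl
enum-P {suc m} P i with splitAt (card (λ s → P (false ∷ s))) i
... | inj₁ a = enum-P (λ s → P (false ∷ s)) a
... | inj₂ b = enum-P (λ s → P (true ∷ s)) b

splitAt-injective : ∀ a b {i j : Fin (a + b)} → splitAt a i ≡ splitAt a j → i ≡ j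
splitAt-injective a b {i} {j} h =
  trans (sym (FinP.join-splitAt a b i)) (trans (cong (join a b) h) (FinP.join-splitAt a b j))

enum-inj : ∀ {m} (P : Vec Bool m → Bool) i j → enum P i ≡ enum P j → i ≡ j
enum-inj {zero} P i j _ with P []
enum-inj {zero} P zero zero _ | true = refl
enum-inj {suc m} P i j h
  with splitAt (card (λ s → P (false ∷ s))) i in ei | splitAt (card (λ s → P (false ∷ s))) j in ej
... | inj₁ a | inj₁ a' = splitAt-injective _ _ (trans ei (trans (cong inj₁ (enum-inj _ a a' (VecP.∷-injectiveʳ h))) (sym ej)))
... | inj₂ b | inj₂ b' = splitAt-injective _ _ (trans ei (trans (cong inj₂ (enum-inj _ b b' (VecP.∷-injectiveʳ h))) (sym ej)))
... | inj₁ a | inj₂ b' with () ← VecP.∷-injectiveˡ h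
... | inj₂ b | inj₁ a' with () ← VecP.∷-injectiveˡ h

enum-↑ˡ : ∀ {m} (P : Vec Bool (suc m) → Bool) a → enum P (a ↑ˡ _) ≡ false ∷ enum (λ s → P (false ∷ s)) a
enum-↑ˡ P a rewrite FinP.splitAt-↑ˡ (card (λ s → P (false ∷ s))) a (card (λ s → P (true ∷ s))) = refl

enum-↑ʳ : ∀ {m} (P : Vec Bool (suc m) → Bool) b → enum P (card (λ s → P (false ∷ s)) ↑ʳ b) ≡ true ∷ enum (λ s → P (true ∷ s)) b
enum-↑ʳ P b rewrite FinP.splitAt-↑ʳ (card (λ s → P (false ∷ s))) (card (λ s → P (true ∷ s))) b = refl

enum-surj : ∀ {m} (P : Vec Bool m → Bool) s → P s ≡ true → Σ (Fin (card P)) λ i → enum P i ≡ s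
enum-surj {zero} P [] h = subst (λ b → Fin (b2n b)) (sym h) zero , refl
enum-surj {suc m} P (false ∷ s) h with enum-surj (λ s → P (false ∷ s)) s h
... | a , refl = (a ↑ˡ _) , enum-↑ˡ P a
enum-surj {suc m} P (true ∷ s) h with enum-surj (λ s → P (true ∷ s)) s h
... | b , refl = (card (λ s → P (false ∷ s)) ↑ʳ b) , enum-↑ʳ P b

card-≤ : ∀ {m m'} (P : Vec Bool m → Bool) (Q : Vec Bool m' → Bool) (f : Vec Bool m → Vec Bool m') →
         (∀ s → P s ≡ true → Q (f s) ≡ true) →
         (∀ s t → P s ≡ true → P t ≡ true → f s ≡ f t → s ≡ t) → card P ≤ card Q
card-≤ P Q f PQ f-inj = FinP.injective⇒≤ {f = index} index-inj
  where
  index : Fin (card P) → Fin (card Q)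
  index i = proj₁ (enum-surj Q (f (enum P i)) (PQ _ (enum-P P i)))
  index-inj : ∀ {i j} → index i ≡ index j → i ≡ j
  index-inj {i} {j} e = enum-inj P i j (f-inj _ _ (enum-P P i) (enum-P P j) (begin
    f (enum P i)      ≡⟨ proj₂ (enum-surj Q (f (enum P i)) _) ⟨
    enum Q (index i)  ≡⟨ cong (enum Q) e ⟩
    enum Q (index j)  ≡⟨ proj₂ (enum-surj Q (f (enum P j)) _) ⟩
    f (enum P j)      ∎))

card-≡ : ∀ {m m'} (P : Vec Bool m → Bool) (Q : Vec Bool m' → Bool)
         (f : Vec Bool m → Vec Bool m') (g : Vec Bool m' → Vec Bool m) →
         (∀ s → P s ≡ true → Q (f s) ≡ true) →
         (∀ s t → P s ≡ true → P t ≡ true → f s ≡ f t → s ≡ t) →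
         (∀ s → Q s ≡ true → P (g s) ≡ true) →
         (∀ s t → Q s ≡ true → Q t ≡ true → g s ≡ g t → s ≡ t) → card P ≡ card Q
card-≡ P Q f g PQ f-inj QP g-inj = ℕP.≤-antisym (card-≤ P Q f PQ f-inj) (card-≤ Q P g QP g-inj)

card-cong : ∀ {m} (P Q : Vec Bool m → Bool) → (∀ s → P s ≡ Q s) → card P ≡ card Q
card-cong {zero} P Q h = cong b2n (h [])
card-cong {suc m} P Q h = cong₂ _+_ (card-cong _ _ (λ s → h (false ∷ s))) (card-cong _ _ (λ s → h (true ∷ s)))

card-false : ∀ {m} → card {m} (λ _ → false) ≡ 0
card-false {zero} = refl
card-false {suc m} = cong₂ _+_ (card-false {m}) (card-false {m})

card-split : ∀ {m} (P Q : Vec Bool m → Bool) → card P ≡ card (λ s → P s ∧ Q s) + card (λ s → P s ∧ not (Q s))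
card-split {zero} P Q with P [] | Q []
... | true | true = refl
... | true | false = refl
... | false | true = refl
... | false | false = refl
card-split {suc m} P Q = trans
  (cong₂ _+_ (card-split (λ s → P (false ∷ s)) (λ s → Q (false ∷ s))) (card-split (λ s → P (true ∷ s)) (λ s → Q (true ∷ s))))
  (interchange (card (λ s → P (false ∷ s) ∧ Q (false ∷ s))) (card (λ s → P (false ∷ s) ∧ not (Q (false ∷ s))))
                (card (λ s → P (true ∷ s) ∧ Q (true ∷ s))) (card (λ s → P (true ∷ s) ∧ not (Q (true ∷ s)))))

suc-mod : ∀ N .{{_ : NonZero N}} a → suc (a % N) % N ≡ suc a % N
suc-mod N a = begin
  (1 + a % N) % N              ≡⟨ %-distribˡ-+ 1 (a % N) N ⟩
  (1 % N + a % N % N) % N      ≡⟨ cong (λ w → (1 % N + w) % N) (m%n%n≡m%n a N) ⟩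
  (1 % N + a % N) % N          ≡⟨ %-distribˡ-+ 1 a N ⟨
  (1 + a) % N                  ∎

module Cycle (n' : ℕ) where
  N : ℕ
  N = suc n'

  next : Fin N → Fin N
  next i = fromℕ< (m%n<n (suc (toℕ i)) N)

  toℕ-next : ∀ i → toℕ (next i) ≡ suc (toℕ i) % N
  toℕ-next i = FinP.toℕ-fromℕ< (m%n<n (suc (toℕ i)) N)

  rot : ℕ → Fin N → Fin N
  rot zero x = x
  rot (suc r) x = next (rot r x)

  toℕ-rot : ∀ r x → toℕ (rot r x) ≡ (toℕ x + r) % N
  toℕ-rot zero x = sym (trans (cong (_% N) (ℕP.+-identityʳ (toℕ x))) (m<n⇒m%n≡m (FinP.toℕ<n x)))
  toℕ-rot (suc r) x = begin
    toℕ (next (rot r x))       ≡⟨ toℕ-next (rot r x) ⟩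
    suc (toℕ (rot r x)) % N    ≡⟨ cong (λ w → suc w % N) (toℕ-rot r x) ⟩
    suc ((toℕ x + r) % N) % N  ≡⟨ suc-mod N (toℕ x + r) ⟩
    suc (toℕ x + r) % N        ≡⟨ cong (_% N) (ℕP.+-suc (toℕ x) r) ⟨
    (toℕ x + suc r) % N        ∎

  rot-next : ∀ r x → rot r (next x) ≡ next (rot r x)
  rot-next zero x = refl
  rot-next (suc r) x = cong next (rot-next r x)

  rot-+ : ∀ a b x → rot a (rot b x) ≡ rot (a + b) x
  rot-+ zero b x = refl
  rot-+ (suc a) b x = cong next (rot-+ a b x)

  rot-N : ∀ x → rot N x ≡ x
  rot-N x = FinP.toℕ-injective (trans (toℕ-rot N x) (trans ([m+n]%n≡m%n (toℕ x) N) (m<n⇒m%n≡m (FinP.toℕ<n x))))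

  next-inj : ∀ {x y} → next x ≡ next y → x ≡ y
  next-inj {x} {y} h = begin
    x                 ≡⟨ rot-N x ⟨
    next (rot n' x)   ≡⟨ rot-next n' x ⟨
    rot n' (next x)   ≡⟨ cong (rot n') h ⟩
    rot n' (next y)   ≡⟨ rot-next n' y ⟩
    next (rot n' y)   ≡⟨ rot-N y ⟩
    y                 ∎

  rot-inj : ∀ r {x y} → rot r x ≡ rot r y → x ≡ y
  rot-inj zero h = h
  rot-inj (suc r) h = rot-inj r (next-inj h)

  toℕ-rot-zero : ∀ k → k < N → toℕ (rot k zero) ≡ k
  toℕ-rot-zero k k<N = trans (toℕ-rot k zero) (m<n⇒m%n≡m k<N)

  rot-toℕ : ∀ i → rot (toℕ i) zero ≡ i
  rot-toℕ i = FinP.toℕ-injective (toℕ-rot-zero (toℕ i) (FinP.toℕ<n i))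

  rot-comm : ∀ r x → rot r x ≡ rot (toℕ x) (rot r zero)
  rot-comm r x = begin
    rot r x                       ≡⟨ cong (rot r) (rot-toℕ x) ⟨
    rot r (rot (toℕ x) zero)      ≡⟨ rot-+ r (toℕ x) zero ⟩
    rot (r + toℕ x) zero          ≡⟨ cong (λ w → rot w zero) (ℕP.+-comm r (toℕ x)) ⟩
    rot (toℕ x + r) zero          ≡⟨ rot-+ (toℕ x) r zero ⟨
    rot (toℕ x) (rot r zero)      ∎

  rot-fixed : ∀ r x → rot r x ≡ x → r < N → r ≡ 0
  rot-fixed r x h r<N = trans (sym (toℕ-rot-zero r r<N)) (cong toℕ (rot-inj (toℕ x)
    (trans (sym (rot-comm r x)) (trans h (sym (rot-toℕ x))))))

  next≢ : 2 ≤ N → ∀ x → next x ≢ x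
  next≢ h x e with rot-fixed 1 x e h
  ... | ()

  next²≢ : 3 ≤ N → ∀ x → next (next x) ≢ x
  next²≢ h x e with rot-fixed 2 x e h
  ... | ()

  next-inject₁ : ∀ (i : Fin n') → next (inject₁ i) ≡ suc i
  next-inject₁ i = FinP.toℕ-injective (begin
    toℕ (next (inject₁ i))     ≡⟨ toℕ-next (inject₁ i) ⟩
    suc (toℕ (inject₁ i)) % N  ≡⟨ cong (λ w → suc w % N) (FinP.toℕ-inject₁ i) ⟩
    suc (toℕ i) % N            ≡⟨ m<n⇒m%n≡m (s≤s (FinP.toℕ<n i)) ⟩
    suc (toℕ i)                ∎)

  next-last : next (fromℕ n') ≡ zero
  next-last = FinP.toℕ-injective (trans (toℕ-next (fromℕ n')) (trans (cong (λ w → suc w % N) (FinP.toℕ-fromℕ n')) (n%n≡0 N)))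

  opposite-next : ∀ y → opposite y ≡ next (opposite (next y))
  opposite-next y with inner-or-last y
  ... | inj₁ (i , refl) = begin
    opposite (inject₁ i)              ≡⟨ opposite-inject₁ i ⟩
    suc (opposite i)                  ≡⟨ next-inject₁ (opposite i) ⟨
    next (inject₁ (opposite i))       ≡⟨ cong next (cong opposite (next-inject₁ i)) ⟨
    next (opposite (next (inject₁ i)))  ∎
  ... | inj₂ refl = begin
    opposite (fromℕ n')               ≡⟨ opposite-fromℕ n' ⟩
    zero                              ≡⟨ next-last ⟨
    next (fromℕ n')                   ≡⟨⟩
    next (opposite zero)              ≡⟨ cong (λ w → next (opposite w)) next-last ⟨
    next (opposite (next (fromℕ n'))) ∎

  CycFib : Vec Bool N → Set
  CycFib u = ∀ i → lookup u i ∧ lookup u (next i) ≡ false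

  last-lookup : ∀ {k} (u : Vec Bool (suc k)) → last u ≡ lookup u (fromℕ k)
  last-lookup (x ∷ []) = refl
  last-lookup (x ∷ y ∷ u) = last-lookup (y ∷ u)

  consecutive-inject₁ : ∀ (j : Fin n') → Consecutive (inject₁ j) (suc j)
  consecutive-inject₁ j = cong suc (sym (FinP.toℕ-inject₁ j))

  lucas⇒CycFib : ∀ u → lucasOk u ≡ true → CycFib u
  lucas⇒CycFib (x ∷ u) h i with inner-or-last i
  ... | inj₁ (j , refl) = subst (λ w → lookup (x ∷ u) (inject₁ j) ∧ lookup (x ∷ u) w ≡ false) (sym (next-inject₁ j))
                            (noCons⇒FibAt (x ∷ u) (∧-l h) (inject₁ j) (suc j) (consecutive-inject₁ j))
  ... | inj₂ refl = subst (λ w → lookup (x ∷ u) (fromℕ n') ∧ lookup (x ∷ u) w ≡ false) (sym next-last)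
          (trans (∧-comm (lookup (x ∷ u) (fromℕ n')) x) (trans (cong (x ∧_) (sym (last-lookup (x ∷ u)))) (not-t (∧-r h))))

  CycFib⇒lucas : ∀ u → CycFib u → lucasOk u ≡ true
  CycFib⇒lucas (x ∷ u) h = ∧-i path wrap
    where
    path : noCons (x ∷ u) ≡ true
    path = FibAt⇒noCons (x ∷ u) λ i j e → subst (λ w → lookup (x ∷ u) i ∧ lookup (x ∷ u) w ≡ false) (next-consecutive i j e) (h i)
      where
      next-consecutive : ∀ i j → Consecutive i j → next i ≡ j
      next-consecutive i j e = FinP.toℕ-injective (trans (toℕ-next i) (trans (cong (_% N) (sym e)) (m<n⇒m%n≡m (FinP.toℕ<n j))))
    wrap : not (x ∧ last (x ∷ u)) ≡ true
    wrap = t-not (trans (cong (x ∧_) (last-lookup (x ∷ u)))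
                 (trans (∧-comm x _) (subst (λ w → lookup (x ∷ u) (fromℕ n') ∧ lookup (x ∷ u) w ≡ false) next-last (h (fromℕ n')))))

-- The Lucas cube Λ_N for N = m + 3, viewed as strings on the N-cycle.
module Lucas (m : ℕ) where
  open Cycle (suc (suc m)) public

  2≤N : 2 ≤ N
  2≤N = s≤s (s≤s z≤n)

  3≤N : 3 ≤ N
  3≤N = s≤s (s≤s (s≤s z≤n))

  one-then-zero : ∀ X p → CycFib X → lookup X p ≡ true → lookup X (next p) ≡ false
  one-then-zero X p cf h = trans (sym (cong (_∧ lookup X (next p)) h)) (cf p)

  zero-then-one : ∀ X y → CycFib X → lookup X (next y) ≡ true → lookup X y ≡ false
  zero-then-one X y cf h = trans (sym (∧-identityʳ _)) (trans (cong (lookup X y ∧_) (sym h)) (cf y))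

  CycFib-sub : ∀ u w → (∀ y → lookup w y ≡ true → lookup u y ≡ true) → CycFib u → CycFib w
  CycFib-sub u w sub cf y = ¬true⇒false λ h →
    t≢f (trans (sym (∧-i (sub y (∧-l h)) (sub (next y) (∧-r h)))) (cf y))

  lucas-zero : lucasOk (zeroV {N}) ≡ true
  lucas-zero = CycFib⇒lucas zeroV λ i → cong (_∧ lookup (zeroV {N}) (next i)) (lookup-zeroV i)

  lucas-unit : ∀ i → lucasOk (flip i (zeroV {N})) ≡ true
  lucas-unit i = CycFib⇒lucas (flip i zeroV) λ y → ¬true⇒false λ h →
    next≢ 2≤N i (trans (cong next (sym (unit-support i y (∧-l h)))) (unit-support i (next y) (∧-r h)))

  lucas-down : ∀ u i → lucasOk u ≡ true → lookup u i ≡ true → lucasOk (flip i u) ≡ true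
  lucas-down u i h ui = CycFib⇒lucas (flip i u) (CycFib-sub u (flip i u) (flip-sub u i ui) (lucas⇒CycFib u h))

  lucas-blocked : ∀ c t → lucasOk c ≡ true → lookup c t ≡ true → Σ (Fin N) λ p → lucasOk (flip p c) ≡ false
  lucas-blocked c t h ct = next t , ¬true⇒false λ h' → t≢f (trans (sym (∧-i c'-t c'-next)) (lucas⇒CycFib (flip (next t) c) h' t))
    where
    c'-t : lookup (flip (next t) c) t ≡ true
    c'-t = trans (flip-other (next t) t c (next≢ 2≤N t)) ct
    c'-next : lookup (flip (next t) c) (next t) ≡ true
    c'-next = trans (flip-same (next t) c) (cong not (one-then-zero c t (lucas⇒CycFib c h) ct))

  open Rigid lucasOk lucas-zero lucas-unit lucas-down lucas-blocked public

  pair-CycFib : ∀ a b → b ≢ next a → a ≢ next b → CycFib (pair a b)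
  pair-CycFib a b x y z = ¬true⇒false λ h → cases (pair-support a b z (∧-l h)) (pair-support a b (next z) (∧-r h))
    where
    cases : (z ≡ a) ⊎ (z ≡ b) → (next z ≡ a) ⊎ (next z ≡ b) → ⊥
    cases (inj₁ p) (inj₁ q) = next≢ 2≤N z (trans q (sym p))
    cases (inj₁ p) (inj₂ q) = x (sym (trans (cong next (sym p)) q))
    cases (inj₂ p) (inj₁ q) = y (trans (sym q) (cong next p))
    cases (inj₂ p) (inj₂ q) = next≢ 2≤N z (trans q (sym p))

  -- The permutation of an automorphism keeps cyclic neighbours adjacent:
  -- otherwise e_{π i} + e_{π (next i)} would be a vertex, and pulling it back
  -- would give a Lucas string with ones at i and next i.
  perm-adjacent : (φ : Aut G) → ∀ i → (perm φ (next i) ≡ next (perm φ i)) ⊎ (perm φ i ≡ next (perm φ (next i)))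
  perm-adjacent φ i = decide (b ≟ next a) (a ≟ next b)
    where
    a = perm φ i
    b = perm φ (next i)
    no-pair : b ≢ next a → a ≢ next b → ⊥
    no-pair x y = t≢f (trans (sym (∧-i wi wni)) (lucas⇒CycFib (proj₁ w) (proj₂ w) i))
      where
      pulled = pair-pullback φ i (next i) (λ e → next≢ 2≤N i (sym e)) (CycFib⇒lucas (pair a b) (pair-CycFib a b x y))
      w = proj₁ pulled
      wi = proj₁ (proj₂ pulled)
      wni = proj₂ (proj₂ pulled)
    decide : Dec (b ≡ next a) → Dec (a ≡ next b) → (b ≡ next a) ⊎ (a ≡ next b)
    decide (yes e) _ = inj₁ e
    decide (no _) (yes e) = inj₂ e
    decide (no x) (no y) = ⊥-elim (no-pair x y)

  Rotational Reflective : (Fin N → Fin N) → Set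
  Rotational f = ∀ x → f (next x) ≡ next (f x)
  Reflective f = ∀ x → f x ≡ next (f (next x))

  -- An injective map keeping cyclic neighbours adjacent is a symmetry of the
  -- cycle: the orientation chosen at 0 propagates around the cycle, since a
  -- switch would make f identify two positions at distance 2.
  dihedral : (f : Fin N → Fin N) → (∀ {x y} → f x ≡ f y → x ≡ y) →
             (∀ i → (f (next i) ≡ next (f i)) ⊎ (f i ≡ next (f (next i)))) → Rotational f ⊎ Reflective f
  dihedral f inj adj with adj zero
  ... | inj₁ h0 = inj₁ λ x → subst (λ w → f (next w) ≡ next (f w)) (rot-toℕ x) (A (toℕ x))
    where
    A : ∀ k → f (next (rot k zero)) ≡ next (f (rot k zero))
    A zero = h0
    A (suc k) with adj (rot (suc k) zero)
    ... | inj₁ q = q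
    ... | inj₂ q = ⊥-elim (next²≢ 3≤N (rot k zero) (inj (next-inj (trans (sym q) (A k)))))
  ... | inj₂ h0 = inj₂ λ x → subst (λ w → f w ≡ next (f (next w))) (rot-toℕ x) (B (toℕ x))
    where
    B : ∀ k → f (rot k zero) ≡ next (f (next (rot k zero)))
    B zero = h0
    B (suc k) with adj (rot (suc k) zero)
    ... | inj₂ q = q
    ... | inj₁ q = ⊥-elim (next²≢ 3≤N (rot k zero) (inj (trans q (sym (B k)))))

  rotational-rot : ∀ f → Rotational f → ∀ r x → f (rot r x) ≡ rot r (f x)
  rotational-rot f c zero x = refl
  rotational-rot f c (suc r) x = trans (c (rot r x)) (cong next (rotational-rot f c r x))

  reflective-rot : ∀ f → Reflective f → ∀ r x → rot r (f (rot r x)) ≡ f x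
  reflective-rot f a zero x = refl
  reflective-rot f a (suc r) x = begin
    next (rot r (f (next (rot r x))))  ≡⟨ rot-next r (f (next (rot r x))) ⟨
    rot r (next (f (next (rot r x))))  ≡⟨ cong (rot r) (a (rot r x)) ⟨
    rot r (f (rot r x))                ≡⟨ reflective-rot f a r x ⟩
    f x                                ∎

  -- The window of X at p: the m positions p+2, …, p+m+1, i.e. all positions
  -- except p and its two neighbours, read along the cycle.
  pos : Fin m → Fin N → Fin N
  pos k p = rot (suc (suc (toℕ k))) p

  window : Vec Bool N → Fin N → Vec Bool m
  window X p = tabulate (λ k → lookup X (pos k p))

  lookup-window : ∀ X p k → lookup (window X p) k ≡ lookup X (pos k p)
  lookup-window X p k = VecP.lookup∘tabulate (λ k → lookup X (pos k p)) k

  -- Going from p to pos k p and on to pos (opposite k) of that returns to p.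
  window-span : ∀ (k : Fin m) → suc (suc (toℕ k)) + suc (suc (toℕ (opposite k))) ≡ N
  window-span k = cong (λ w → suc (suc w)) (begin
    toℕ k + suc (suc (toℕ (opposite k)))   ≡⟨ ℕP.+-suc (toℕ k) _ ⟩
    suc (toℕ k + suc (toℕ (opposite k)))   ≡⟨ cong suc (ℕP.+-suc (toℕ k) _) ⟩
    suc (suc (toℕ k) + toℕ (opposite k))   ≡⟨ cong (λ w → suc (suc (toℕ k) + w)) (FinP.opposite-prop k) ⟩
    suc (suc (toℕ k) + (m ∸ suc (toℕ k)))  ≡⟨ cong suc (ℕP.m+[n∸m]≡n (FinP.toℕ<n k)) ⟩
    suc m                                  ∎)

  window-rotational : ∀ X Y f → (∀ j → lookup Y (f j) ≡ lookup X j) → Rotational f → ∀ p → window Y (f p) ≡ window X p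
  window-rotational X Y f h c p = vec-ext λ k → begin
    lookup (window Y (f p)) k  ≡⟨ lookup-window Y (f p) k ⟩
    lookup Y (pos k (f p))     ≡⟨ cong (lookup Y) (rotational-rot f c (suc (suc (toℕ k))) p) ⟨
    lookup Y (f (pos k p))     ≡⟨ h (pos k p) ⟩
    lookup X (pos k p)         ≡⟨ lookup-window X p k ⟨
    lookup (window X p) k      ∎

  window-reflective : ∀ X Y f → (∀ j → lookup Y (f j) ≡ lookup X j) → Reflective f → ∀ p → window Y (f p) ≡ reverse (window X p)
  window-reflective X Y f h a p = vec-ext λ k → begin
    lookup (window Y (f p)) k             ≡⟨ lookup-window Y (f p) k ⟩
    lookup Y (pos k (f p))                ≡⟨ cong (lookup Y) (turn k) ⟩
    lookup Y (f (pos (opposite k) p))     ≡⟨ h (pos (opposite k) p) ⟩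
    lookup X (pos (opposite k) p)         ≡⟨ lookup-window X p (opposite k) ⟨
    lookup (window X p) (opposite k)      ≡⟨ lookup-reverse (window X p) k ⟨
    lookup (reverse (window X p)) k       ∎
    where
    back-to-p : ∀ k → pos k (pos (opposite k) p) ≡ p
    back-to-p k = trans (rot-+ (suc (suc (toℕ k))) _ p) (trans (cong (λ w → rot w p) (window-span k)) (rot-N p))
    turn : ∀ k → pos k (f p) ≡ f (pos (opposite k) p)
    turn k = trans (cong (λ w → pos k (f w)) (sym (back-to-p k))) (reflective-rot f a (suc (suc (toℕ k))) (pos (opposite k) p))

  pos≢ : ∀ k p → pos k p ≢ p
  pos≢ k p e with rot-fixed (suc (suc (toℕ k))) p e (s≤s (s≤s (ℕP.<⇒≤ (s≤s (FinP.toℕ<n k)))))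
  ... | ()

  window-flip : ∀ X p → window (flip p X) p ≡ window X p
  window-flip X p = vec-ext λ k →
    trans (lookup-window (flip p X) p k) (trans (flip-other p (pos k p) X (λ e → pos≢ k p (sym e))) (sym (lookup-window X p k)))

  window-noCons : ∀ X p → CycFib X → noCons (window X p) ≡ true
  window-noCons X p cf = FibAt⇒noCons (window X p) λ i j e → begin
    lookup (window X p) i ∧ lookup (window X p) j  ≡⟨ cong₂ _∧_ (lookup-window X p i) (lookup-window X p j) ⟩
    lookup X (pos i p) ∧ lookup X (pos j p)        ≡⟨ cong (λ w → lookup X (pos i p) ∧ lookup X (rot (suc (suc w)) p)) e ⟩
    lookup X (pos i p) ∧ lookup X (next (pos i p)) ≡⟨ cf (pos i p) ⟩
    false                                          ∎

  -- A Lucas string with a 1 at p is determined by its window at p: the two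
  -- neighbours of p are 0.
  window-determines : ∀ X Y p → CycFib X → CycFib Y → lookup X p ≡ true → lookup Y p ≡ true →
                      window X p ≡ window Y p → X ≡ Y
  window-determines X Y p cx cy xp yp w = vec-ext λ y →
    subst (λ v → lookup X v ≡ lookup Y v) (reach y) (at (toℕ (back y)) (FinP.toℕ<n (back y)))
    where
    at : ∀ r → r < N → lookup X (rot r p) ≡ lookup Y (rot r p)
    at zero _ = trans xp (sym yp)
    at (suc zero) _ = trans (one-then-zero X p cx xp) (sym (one-then-zero Y p cy yp))
    at (suc (suc k)) lt with k ℕP.<? m
    ... | yes k<m = begin
      lookup X (rot (suc (suc k)) p)       ≡⟨ cong (λ v → lookup X (rot (suc (suc v)) p)) (FinP.toℕ-fromℕ< k<m) ⟨
      lookup X (pos (fromℕ< k<m) p)        ≡⟨ lookup-window X p (fromℕ< k<m) ⟨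
      lookup (window X p) (fromℕ< k<m)     ≡⟨ cong (λ s → lookup s (fromℕ< k<m)) w ⟩
      lookup (window Y p) (fromℕ< k<m)     ≡⟨ lookup-window Y p (fromℕ< k<m) ⟩
      lookup Y (pos (fromℕ< k<m) p)        ≡⟨ cong (λ v → lookup Y (rot (suc (suc v)) p)) (FinP.toℕ-fromℕ< k<m) ⟩
      lookup Y (rot (suc (suc k)) p)       ∎
    ... | no k≮m = trans (zero-then-one X _ cx (trans (cong (lookup X) last-before-p) xp))
                         (sym (zero-then-one Y _ cy (trans (cong (lookup Y) last-before-p) yp)))
      where
      k≡m : k ≡ m
      k≡m = ℕP.≤-antisym (ℕP.≤-pred (ℕP.≤-pred (ℕP.≤-pred lt))) (ℕP.≮⇒≥ k≮m)
      last-before-p : next (rot (suc (suc k)) p) ≡ p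
      last-before-p = trans (cong (λ w → rot (suc (suc (suc w))) p) k≡m) (rot-N p)
    I = invert (rot (toℕ p)) (rot-inj (toℕ p))
    back : Fin N → Fin N
    back = proj₁ I
    reach : ∀ y → rot (toℕ (back y)) p ≡ y
    reach y = trans (rot-comm (toℕ (back y)) p) (trans (cong (rot (toℕ p)) (rot-toℕ (back y))) (proj₁ (proj₂ I) y))


noCons-∷ʳ-false : ∀ {k} (c : Vec Bool k) → noCons (c ∷ʳ false) ≡ noCons c
noCons-∷ʳ-false [] = refl
noCons-∷ʳ-false (x ∷ []) = trans (∧-identityʳ (not (x ∧ false))) (cong not (∧-zeroʳ x))
noCons-∷ʳ-false (x ∷ y ∷ c) = cong (not (x ∧ y) ∧_) (noCons-∷ʳ-false (y ∷ c))

-- The edge {u, flip p u} gets the invariant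
-- canon (window u p).  It is constant on orbits because automorphisms are
-- dihedral; conversely a symmetry of the cycle maps the representative edge
-- {1 0 c 0, 0 0 c 0} onto every edge with invariant c.
module LucasEdges (m : ℕ) where
  open Lucas m

  E : Set
  E = Edge G

  edge-pos : E → Fin N
  edge-pos (u , v , a) = proj₁ (ham1 (proj₁ u) (proj₁ v) a)

  edge-pos-spec : ∀ (e : E) → proj₁ (proj₁ (proj₂ e)) ≡ flip (edge-pos e) (proj₁ (proj₁ e))
  edge-pos-spec (u , v , a) = proj₂ (ham1 (proj₁ u) (proj₁ v) a)

  invariant : E → Vec Bool m
  invariant e = canon (window (proj₁ (proj₁ e)) (edge-pos e))

  invariant-swap : ∀ u v (a : Graph.Adj G u v) (a' : Graph.Adj G v u) → invariant (v , u , a') ≡ invariant (u , v , a)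
  invariant-swap u v a a' = begin
    canon (window (proj₁ v) (edge-pos (v , u , a')))  ≡⟨ cong (λ w → canon (window (proj₁ v) w)) same-pos ⟩
    canon (window (proj₁ v) p)                        ≡⟨ cong (λ w → canon (window w p)) (edge-pos-spec (u , v , a)) ⟩
    canon (window (flip p (proj₁ u)) p)               ≡⟨ cong canon (window-flip (proj₁ u) p) ⟩
    canon (window (proj₁ u) p)                        ∎
    where
    p = edge-pos (u , v , a)
    same-pos : edge-pos (v , u , a') ≡ p
    same-pos = flip-pos _ _ (proj₁ v) (begin
      flip (edge-pos (v , u , a')) (proj₁ v)  ≡⟨ edge-pos-spec (v , u , a') ⟨
      proj₁ u                                 ≡⟨ flip-invol p (proj₁ u) ⟨
      flip p (flip p (proj₁ u))               ≡⟨ cong (flip p) (edge-pos-spec (u , v , a)) ⟨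
      flip p (proj₁ v)                        ∎)

  -- The invariant is preserved by automorphisms: the flipped coordinate
  -- moves along π, and windows move along π up to reversal.
  invariant-image : (g : Aut G) → ∀ u v (a : Graph.Adj G u v) (a' : Graph.Adj G (Aut.to g u) (Aut.to g v)) →
                    invariant (Aut.to g u , Aut.to g v , a') ≡ invariant (u , v , a)
  invariant-image g u v a a' = begin
    canon (window gu (edge-pos (Aut.to g u , Aut.to g v , a')))  ≡⟨ cong (λ w → canon (window gu w)) pos-image ⟩
    canon (window gu (perm g p))                                 ≡⟨ by-symmetry (dihedral (perm g) (perm-inj g) (perm-adjacent g)) ⟩
    canon (window (proj₁ u) p)                                   ∎
    where
    p = edge-pos (u , v , a)
    gu = proj₁ (Aut.to g u)
    pos-image : edge-pos (Aut.to g u , Aut.to g v , a') ≡ perm g p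
    pos-image = flip-pos _ _ gu (trans (sym (edge-pos-spec (Aut.to g u , Aut.to g v , a')))
                                       (flip-image g u v p (edge-pos-spec (u , v , a))))
    by-symmetry : Rotational (perm g) ⊎ Reflective (perm g) → canon (window gu (perm g p)) ≡ canon (window (proj₁ u) p)
    by-symmetry (inj₁ r) = cong canon (window-rotational (proj₁ u) gu (perm g) (act g u) r p)
    by-symmetry (inj₂ r) = trans (cong canon (window-reflective (proj₁ u) gu (perm g) (act g u) r p))
                                 (canon-reverse (window (proj₁ u) p))

  invariant-orbit : ∀ e e' → SameEOrbit G e e' → invariant e ≡ invariant e'
  invariant-orbit (u , v , a) (u' , v' , a') (g , inj₁ (refl , refl)) = sym (invariant-image g u v a a')
  invariant-orbit (u , v , a) (u' , v' , a') (g , inj₂ (refl , refl)) =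
    sym (trans (invariant-swap (Aut.to g u) (Aut.to g v) (trans (ham-sym (proj₁ (Aut.to g u)) (proj₁ (Aut.to g v))) a') a') (invariant-image g u v a _))

  rotational-inverse : ∀ σ τ → (∀ y → σ (τ y) ≡ y) → (∀ x → τ (σ x) ≡ x) → Rotational σ → Rotational τ
  rotational-inverse σ τ στ τσ r y = begin
    τ (next y)           ≡⟨ cong (λ w → τ (next w)) (στ y) ⟨
    τ (next (σ (τ y)))   ≡⟨ cong τ (r (τ y)) ⟨
    τ (σ (next (τ y)))   ≡⟨ τσ (next (τ y)) ⟩
    next (τ y)           ∎

  reflective-inverse : ∀ σ τ → (∀ y → σ (τ y) ≡ y) → (∀ x → τ (σ x) ≡ x) → Reflective σ → Reflective τ
  reflective-inverse σ τ στ τσ r y =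
    trans (cong τ (next-inj (trans (sym (στ (next y))) (r _)))) (τσ (next (τ (next y))))

  permute-CycFib : ∀ f → Rotational f ⊎ Reflective f → ∀ u → CycFib u → CycFib (permute f u)
  permute-CycFib f (inj₁ r) u cf y =
    trans (cong₂ _∧_ (lookup-permute f u y) (trans (lookup-permute f u (next y)) (cong (lookup u) (r y)))) (cf (f y))
  permute-CycFib f (inj₂ r) u cf y =
    trans (cong₂ _∧_ (trans (lookup-permute f u y) (cong (lookup u) (r y))) (lookup-permute f u (next y)))
          (trans (∧-comm (lookup u (next (f (next y)))) (lookup u (f (next y)))) (cf (f (next y))))

  symmetry-aut : ∀ σ → (∀ {x y} → σ x ≡ σ y → x ≡ y) → Rotational σ ⊎ Reflective σ → Σ (Aut G) λ g → Transports g σ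
  symmetry-aut σ σ-inj sym-σ = PermAut.aut lucasOk σ τ τσ στ (keeps τ sym-τ) (keeps σ sym-σ) , transport
    where
    I = invert σ σ-inj
    τ = proj₁ I
    στ = proj₁ (proj₂ I)
    τσ = proj₂ (proj₂ I)
    sym-τ : Rotational τ ⊎ Reflective τ
    sym-τ = [ (λ r → inj₁ (rotational-inverse σ τ στ τσ r)) , (λ r → inj₂ (reflective-inverse σ τ στ τσ r)) ]′ sym-σ
    keeps : ∀ f → Rotational f ⊎ Reflective f → ∀ u → lucasOk u ≡ true → lucasOk (permute f u) ≡ true
    keeps f s u h = CycFib⇒lucas _ (permute-CycFib f s u (lucas⇒CycFib u h))
    transport : ∀ w j → lookup (permute τ (proj₁ w)) (σ j) ≡ lookup (proj₁ w) j
    transport w j = trans (lookup-permute τ (proj₁ w) (σ j)) (cong (lookup (proj₁ w)) (τσ j))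

  T : Vec Bool m → Vec Bool N
  T c = true ∷ false ∷ (c ∷ʳ false)

  T-lucas : ∀ c → noCons c ≡ true → lucasOk (T c) ≡ true
  T-lucas c h = ∧-i (trans (noCons-10∷ (c ∷ʳ false)) (trans (noCons-∷ʳ-false c) h))
                    (cong not (trans (cong (true ∧_) (last-lookup (T c))) (lookup-∷ʳ-last c false)))
    where
    noCons-10∷ : ∀ {k} (w : Vec Bool (suc k)) → noCons (true ∷ false ∷ w) ≡ noCons w
    noCons-10∷ (y ∷ w) = refl

  window-T : ∀ c → window (T c) zero ≡ c
  window-T c = vec-ext λ k → begin
    lookup (window (T c) zero) k          ≡⟨ lookup-window (T c) zero k ⟩
    lookup (T c) (pos k zero)             ≡⟨ cong (lookup (T c)) (FinP.toℕ-injective position) ⟩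
    lookup (T c) (suc (suc (inject₁ k)))  ≡⟨ lookup-∷ʳ-inject₁ c false k ⟩
    lookup c k                            ∎
    where
    position : ∀ {k} → toℕ (pos k zero) ≡ suc (suc (toℕ (inject₁ k)))
    position {k} = trans (toℕ-rot-zero _ (s≤s (s≤s (ℕP.<⇒≤ (s≤s (FinP.toℕ<n k))))))
                     (cong (λ w → suc (suc w)) (sym (FinP.toℕ-inject₁ k)))

  rep-edge : (c : Vec Bool m) → noCons c ≡ true → E
  rep-edge c h = (T c , T-lucas c h) , (flip zero (T c) , lucas-down (T c) zero (T-lucas c h) refl) , ham-flip zero (T c)

  invariant-rep : ∀ c h → Can c ≡ true → invariant (rep-edge c h) ≡ c
  invariant-rep c h hc = trans (cong canon (window-T c)) (canon-fix c hc)

  -- A symmetry σ with σ 0 = p that transports T c to a string with the same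
  -- window at p as u maps the representative edge onto the edge {u, v}: the
  -- image of T c is whichever endpoint has a 1 at p.
  cover-by : ∀ (u v : V) (a : Graph.Adj G u v) (c : Vec Bool m) (h : noCons c ≡ true) (σ : Fin N → Fin N) →
             (∀ {x y} → σ x ≡ σ y → x ≡ y) → Rotational σ ⊎ Reflective σ → σ zero ≡ edge-pos (u , v , a) →
             (∀ Y → (∀ j → lookup Y (σ j) ≡ lookup (T c) j) → window Y (edge-pos (u , v , a)) ≡ window (proj₁ u) (edge-pos (u , v , a))) →
             SameEOrbit G (rep-edge c h) (u , v , a)
  cover-by u v a c h σ σ-inj sym-σ σ0 same-window = g , endpoints (lookup (proj₁ u) p) refl
    where
    p = edge-pos (u , v , a)
    v≡ : proj₁ v ≡ flip p (proj₁ u)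
    v≡ = edge-pos-spec (u , v , a)
    g = proj₁ (symmetry-aut σ σ-inj sym-σ)
    t = proj₂ (symmetry-aut σ σ-inj sym-σ)
    Tv = proj₁ (rep-edge c h)
    Bv = proj₁ (proj₂ (rep-edge c h))
    Y = proj₁ (Aut.to g Tv)
    Y-p : lookup Y p ≡ true
    Y-p = trans (cong (lookup Y) (sym σ0)) (t Tv zero)
    Y-window : window Y p ≡ window (proj₁ u) p
    Y-window = same-window Y (t Tv)
    Y-cyc : CycFib Y
    Y-cyc = lucas⇒CycFib Y (proj₂ (Aut.to g Tv))
    gB : proj₁ (Aut.to g Bv) ≡ flip p Y
    gB = trans (flip-image g Tv Bv zero refl) (cong (λ r → flip r Y) (trans (transports-perm g σ t zero) σ0))
    endpoints : ∀ b → lookup (proj₁ u) p ≡ b → (Aut.to g Tv ≡ u × Aut.to g Bv ≡ v) ⊎ (Aut.to g Tv ≡ v × Aut.to g Bv ≡ u)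
    endpoints true u-p = inj₁ (vertex-≡ _ u Y≡u , vertex-≡ _ v (trans gB (trans (cong (flip p) Y≡u) (sym v≡))))
      where
      Y≡u : Y ≡ proj₁ u
      Y≡u = window-determines Y (proj₁ u) p Y-cyc (lucas⇒CycFib (proj₁ u) (proj₂ u)) Y-p u-p Y-window
    endpoints false u-p = inj₂ (vertex-≡ _ v Y≡v , vertex-≡ _ u (trans gB (trans (cong (flip p) Y≡v) (trans (cong (flip p) v≡) (flip-invol p _)))))
      where
      v-p : lookup (proj₁ v) p ≡ true
      v-p = trans (cong (λ w → lookup w p) v≡) (trans (flip-same p _) (cong not u-p))
      Y≡v : Y ≡ proj₁ v
      Y≡v = window-determines Y (proj₁ v) p Y-cyc (lucas⇒CycFib (proj₁ v) (proj₂ v)) Y-p v-p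
              (trans Y-window (sym (trans (cong (λ w → window w p) v≡) (window-flip (proj₁ u) p))))

  -- Every edge lies in the orbit of the representative of its invariant:
  -- use the rotation 0 ↦ p if the window is canonical, else the reflection
  -- j ↦ p + 1 - j.
  cover : ∀ (e : E) (h : noCons (invariant e) ≡ true) → SameEOrbit G (rep-edge (invariant e) h) e
  cover (u , v , a) h = by-cases (canon-cases w)
    where
    p = edge-pos (u , v , a)
    w = window (proj₁ u) p
    c = canon w
    by-cases : (c ≡ w) ⊎ (c ≡ reverse w) → SameEOrbit G (rep-edge c h) (u , v , a)
    by-cases (inj₁ c≡w) = cover-by u v a c h (rot (toℕ p)) (rot-inj (toℕ p)) (inj₁ (rot-next (toℕ p))) (rot-toℕ p)
      λ Y hY → trans (cong (window Y) (sym (rot-toℕ p)))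
                     (trans (window-rotational (T c) Y (rot (toℕ p)) hY (rot-next (toℕ p)) zero) (trans (window-T c) c≡w))
    by-cases (inj₂ c≡rw) = cover-by u v a c h σ σ-inj (inj₂ σ-reflective) σ0
      λ Y hY → trans (cong (window Y) (sym σ0))
                     (trans (window-reflective (T c) Y σ hY σ-reflective zero)
                            (trans (cong reverse (trans (window-T c) c≡rw)) (VecP.reverse-involutive w)))
      where
      σ : Fin N → Fin N
      σ j = rot (suc (toℕ p)) (opposite j)
      σ-inj : ∀ {x y} → σ x ≡ σ y → x ≡ y
      σ-inj e = trans (sym (FinP.opposite-involutive _)) (trans (cong opposite (rot-inj (suc (toℕ p)) e)) (FinP.opposite-involutive _))
      σ-reflective : Reflective σ
      σ-reflective y = trans (cong (rot (suc (toℕ p))) (opposite-next y)) (rot-next (suc (toℕ p)) (opposite (next y)))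
      σ0 : σ zero ≡ p
      σ0 = trans (sym (rot-next (toℕ p) (fromℕ (suc (suc m))))) (trans (cong (rot (toℕ p)) next-last) (rot-toℕ p))

  edge-orbits : HasEdgeOrbits G (card (Can {m}))
  edge-orbits = rep , covering , distinct
    where
    C : Vec Bool m → Bool
    C = Can
    rep-Fib : ∀ i → noCons (enum C i) ≡ true
    rep-Fib i = ∧-l {noCons (enum C i)} (enum-P C i)
    rep : Fin (card (Can {m})) → E
    rep i = rep-edge (enum C i) (rep-Fib i)
    covering : ∀ e → ∃ λ i → SameEOrbit G (rep i) e
    covering e = i , subst (λ c → ∀ h → SameEOrbit G (rep-edge c h) e) (sym enum-i) (cover e) (rep-Fib i)
      where
      u₁ = proj₁ (proj₁ e)
      Can-inv : C (invariant e) ≡ true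
      Can-inv = canon-Can (window u₁ (edge-pos e)) (window-noCons u₁ (edge-pos e) (lucas⇒CycFib u₁ (proj₂ (proj₁ e))))
      i = proj₁ (enum-surj C (invariant e) Can-inv)
      enum-i : enum C i ≡ invariant e
      enum-i = proj₂ (enum-surj C (invariant e) Can-inv)
    distinct : ∀ i j → SameEOrbit G (rep i) (rep j) → i ≡ j
    distinct i j o = enum-inj C i j (begin
      enum C i            ≡⟨ invariant-rep (enum C i) (rep-Fib i) (enum-P C i) ⟨
      invariant (rep i)   ≡⟨ invariant-orbit (rep i) (rep j) o ⟩
      invariant (rep j)   ≡⟨ invariant-rep (enum C j) (rep-Fib j) (enum-P C j) ⟩
      enum C j            ∎)

-- Vertex orbits of Γ_M for M = m₀ + 2.  Automorphisms act by permutations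
-- of the path 0 — 1 — ⋯ — M-1 keeping neighbours adjacent, i.e. by the
-- identity or the reversal, so the orbits are the strings up to reversal.

Adjacent : ∀ {M} → Fin M → Fin M → Set
Adjacent a b = Consecutive a b ⊎ Consecutive b a

opposite-adjacent : ∀ {M} {i j : Fin M} → Adjacent i j → Adjacent (opposite i) (opposite j)
opposite-adjacent (inj₁ x) = inj₂ (opposite-consecutive x)
opposite-adjacent (inj₂ x) = inj₁ (opposite-consecutive x)

n≢1+n : ∀ (n : ℕ) → n ≢ suc n
n≢1+n n e = ℕP.1+n≢n (sym e)

n≢2+n : ∀ (n : ℕ) → suc (suc n) ≢ n
n≢2+n n = ℕP.m+1+n≢n 1

module FibonacciCube (m₀ : ℕ) where
  M : ℕ
  M = suc (suc m₀)

  after-one : ∀ (c : Vec Bool M) → noCons c ≡ true → ∀ i j → Consecutive i j → lookup c i ≡ true → lookup c j ≡ false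
  after-one c h i j e ci = trans (sym (cong (_∧ lookup c j) ci)) (noCons⇒FibAt c h i j e)

  before-one : ∀ (c : Vec Bool M) → noCons c ≡ true → ∀ i j → Consecutive i j → lookup c j ≡ true → lookup c i ≡ false
  before-one c h i j e cj = trans (sym (∧-identityʳ _)) (trans (cong (lookup c i ∧_) (sym cj)) (noCons⇒FibAt c h i j e))

  two-ones : ∀ (c : Vec Bool M) i j → Consecutive i j → lookup c i ≡ true → lookup c j ≡ true → noCons c ≡ false
  two-ones c i j e ci cj = ¬true⇒false λ h → t≢f (trans (sym (∧-i ci cj)) (noCons⇒FibAt c h i j e))

  FibAt-sub : ∀ (u w : Vec Bool M) → (∀ y → lookup w y ≡ true → lookup u y ≡ true) → FibAt u → FibAt w
  FibAt-sub u w sub fa i j e = ¬true⇒false λ h → t≢f (trans (sym (∧-i (sub i (∧-l h)) (sub j (∧-r h)))) (fa i j e))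

  fib-zero : noCons (zeroV {M}) ≡ true
  fib-zero = FibAt⇒noCons (zeroV {M}) λ i j e → cong (_∧ lookup (zeroV {M}) j) (lookup-zeroV i)

  fib-unit : ∀ i → noCons (flip i (zeroV {M})) ≡ true
  fib-unit i = FibAt⇒noCons (flip i zeroV) λ a b e → ¬true⇒false λ h →
    n≢1+n (toℕ a) (trans (cong toℕ (trans (unit-support i a (∧-l h)) (sym (unit-support i b (∧-r h))))) e)

  fib-down : ∀ u i → noCons u ≡ true → lookup u i ≡ true → noCons (flip i u) ≡ true
  fib-down u i h ui = FibAt⇒noCons (flip i u) (FibAt-sub u (flip i u) (flip-sub u i ui) (noCons⇒FibAt u h))

  fib-blocked : ∀ c t → noCons c ≡ true → lookup c t ≡ true → Σ (Fin M) λ p → noCons (flip p c) ≡ false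
  fib-blocked c zero h ct = suc zero , two-ones (flip (suc zero) c) zero (suc zero) refl
    (trans (flip-other (suc zero) zero c (λ ())) ct)
    (trans (flip-same (suc zero) c) (cong not (after-one c h zero (suc zero) refl ct)))
  fib-blocked c (suc s) h ct = inject₁ s , two-ones (flip (inject₁ s) c) (inject₁ s) (suc s) e
    (trans (flip-same (inject₁ s) c) (cong not (before-one c h (inject₁ s) (suc s) e ct)))
    (trans (flip-other (inject₁ s) (suc s) c (λ q → n≢1+n (toℕ (inject₁ s)) (trans (cong toℕ q) e))) ct)
    where
    e : Consecutive (inject₁ s) (suc s)
    e = cong suc (sym (FinP.toℕ-inject₁ s))

  open Rigid noCons fib-zero fib-unit fib-down fib-blocked public

  pair-FibAt : ∀ (a b : Fin M) → ¬ Consecutive a b → ¬ Consecutive b a → FibAt (pair a b)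
  pair-FibAt a b x y z w e = ¬true⇒false λ h → cases (pair-support a b z (∧-l h)) (pair-support a b w (∧-r h))
    where
    cases : (z ≡ a) ⊎ (z ≡ b) → (w ≡ a) ⊎ (w ≡ b) → ⊥
    cases (inj₁ p) (inj₁ q) = n≢1+n (toℕ z) (trans (cong toℕ (trans p (sym q))) e)
    cases (inj₁ p) (inj₂ q) = x (trans (cong toℕ (sym q)) (trans e (cong (λ r → suc (toℕ r)) p)))
    cases (inj₂ p) (inj₁ q) = y (trans (cong toℕ (sym q)) (trans e (cong (λ r → suc (toℕ r)) p)))
    cases (inj₂ p) (inj₂ q) = n≢1+n (toℕ z) (trans (cong toℕ (trans p (sym q))) e)

  perm-adjacent : (φ : Aut G) → ∀ i j → Consecutive i j → Adjacent (perm φ i) (perm φ j)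
  perm-adjacent φ i j e = decide (toℕ b ℕP.≟ suc (toℕ a)) (toℕ a ℕP.≟ suc (toℕ b))
    where
    a = perm φ i
    b = perm φ j
    no-pair : ¬ Consecutive a b → ¬ Consecutive b a → ⊥
    no-pair x y = t≢f (trans (sym (∧-i wi wj)) (noCons⇒FibAt (proj₁ w) (proj₂ w) i j e))
      where
      pulled = pair-pullback φ i j (λ q → n≢1+n (toℕ i) (trans (cong toℕ q) e))
                 (FibAt⇒noCons (pair a b) (pair-FibAt a b x y))
      w = proj₁ pulled
      wi = proj₁ (proj₂ pulled)
      wj = proj₂ (proj₂ pulled)
    decide : Dec (Consecutive a b) → Dec (Consecutive b a) → Adjacent a b
    decide (yes x) _ = inj₁ x
    decide (no _) (yes y) = inj₂ y
    decide (no x) (no y) = ⊥-elim (no-pair x y)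

  -- An injective map of the path keeping neighbours adjacent and fixing the
  -- end 0 is the identity: by induction along the path, k + 2 cannot go
  -- back to the image of k.
  path-identity : (f : Fin M → Fin M) → (∀ {a b} → f a ≡ f b → a ≡ b) →
                  (∀ i j → Consecutive i j → Adjacent (f i) (f j)) → toℕ (f zero) ≡ 0 → ∀ i → f i ≡ i
  path-identity f f-inj f-adj f0 i =
    FinP.toℕ-injective (trans (cong (λ w → toℕ (f w)) (sym (FinP.fromℕ<-toℕ i (FinP.toℕ<n i)))) (along (toℕ i) (FinP.toℕ<n i)))
    where
    along : ∀ k (lt : k < M) → toℕ (f (fromℕ< lt)) ≡ k
    along zero lt = f0
    along (suc zero) lt with f-adj (fromℕ< (ℕP.<-trans (s≤s z≤n) lt)) (fromℕ< lt) refl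
    ... | inj₁ q = trans q (cong suc f0)
    ... | inj₂ q = ⊥-elim (ℕP.1+n≢0 (trans (sym q) f0))
    along (suc (suc k)) lt = step (f-adj (fromℕ< lt1) (fromℕ< lt) consec) (along (suc k) lt1) (along k lt0)
      where
      lt1 : suc k < M
      lt1 = ℕP.<-trans (ℕP.n<1+n _) lt
      lt0 : k < M
      lt0 = ℕP.<-trans (ℕP.n<1+n _) lt1
      consec : Consecutive (fromℕ< lt1) (fromℕ< lt)
      consec = trans (FinP.toℕ-fromℕ< lt) (cong suc (sym (FinP.toℕ-fromℕ< lt1)))
      step : Adjacent (f (fromℕ< lt1)) (f (fromℕ< lt)) → toℕ (f (fromℕ< lt1)) ≡ suc k → toℕ (f (fromℕ< lt0)) ≡ k →
             toℕ (f (fromℕ< lt)) ≡ suc (suc k)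
      step (inj₁ q) h1 h0 = trans q (cong suc h1)
      step (inj₂ q) h1 h0 = ⊥-elim (n≢2+n k (begin
        suc (suc k)            ≡⟨ FinP.toℕ-fromℕ< lt ⟨
        toℕ (fromℕ< lt)        ≡⟨ cong toℕ (f-inj (FinP.toℕ-injective (trans (ℕP.suc-injective (trans (sym q) h1)) (sym h0)))) ⟩
        toℕ (fromℕ< lt0)       ≡⟨ FinP.toℕ-fromℕ< lt0 ⟩
        k                      ∎))

  -- A bijection of the path keeping neighbours adjacent (for its inverse
  -- g) sends the end 0 to an end: an inner point has two neighbours, which
  -- would both have to come from the single neighbour 1 of 0.
  end-to-end : (f g : Fin M → Fin M) → (∀ y → f (g y) ≡ y) → (∀ a → g (f a) ≡ a) →
               (∀ i j → Consecutive i j → Adjacent (g i) (g j)) → (toℕ (f zero) ≡ 0) ⊎ (toℕ (f zero) ≡ suc m₀)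
  end-to-end f g fg gf g-adj = from (toℕ (f zero)) refl
    where
    g0 : toℕ (g (f zero)) ≡ 0
    g0 = cong toℕ (gf zero)
    from : ∀ t → toℕ (f zero) ≡ t → (toℕ (f zero) ≡ 0) ⊎ (toℕ (f zero) ≡ suc m₀)
    from zero e = inj₁ e
    from (suc t') e with t' ℕP.≟ m₀
    ... | yes refl = inj₂ e
    ... | no t'≢m₀ = ⊥-elim (n≢2+n t' (begin
      suc (suc t')   ≡⟨ FinP.toℕ-fromℕ< l2 ⟨
      toℕ y2         ≡⟨ cong toℕ y2≡y1 ⟩
      toℕ y1         ≡⟨ FinP.toℕ-fromℕ< l1 ⟩
      t'             ∎))
      where
      t'<m₀ : t' < m₀
      t'<m₀ = ℕP.≤∧≢⇒< (ℕP.≤-pred (ℕP.≤-pred (subst (λ w → w < M) e (FinP.toℕ<n (f zero))))) t'≢m₀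
      l1 : t' < M
      l1 = ℕP.<-trans (ℕP.<-trans t'<m₀ (ℕP.n<1+n _)) (ℕP.n<1+n _)
      l2 : suc (suc t') < M
      l2 = s≤s (s≤s t'<m₀)
      y1 = fromℕ< l1
      y2 = fromℕ< l2
      g-y1 : toℕ (g y1) ≡ 1
      g-y1 with g-adj y1 (f zero) (trans e (cong suc (sym (FinP.toℕ-fromℕ< l1))))
      ... | inj₁ q = ⊥-elim (ℕP.1+n≢0 (trans (sym q) g0))
      ... | inj₂ q = trans q (cong suc g0)
      g-y2 : toℕ (g y2) ≡ 1
      g-y2 with g-adj (f zero) y2 (trans (FinP.toℕ-fromℕ< l2) (cong suc (sym e)))
      ... | inj₁ q = trans q (cong suc g0)
      ... | inj₂ q = ⊥-elim (ℕP.1+n≢0 (trans (sym q) g0))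
      y2≡y1 : y2 ≡ y1
      y2≡y1 = trans (sym (fg y2)) (trans (cong f (FinP.toℕ-injective (trans g-y2 (sym g-y1)))) (fg y1))

  -- Hence such a bijection is the identity or (composed with the
  -- reversal, which fixes the other end) the reversal.
  path-symmetry : (f g : Fin M → Fin M) → (∀ y → f (g y) ≡ y) → (∀ a → g (f a) ≡ a) →
                  (∀ i j → Consecutive i j → Adjacent (f i) (f j)) → (∀ i j → Consecutive i j → Adjacent (g i) (g j)) →
                  (∀ i → f i ≡ i) ⊎ (∀ i → f i ≡ opposite i)
  path-symmetry f g fg gf f-adj g-adj = by-end (end-to-end f g fg gf g-adj)
    where
    f-inj : ∀ {a b} → f a ≡ f b → a ≡ b
    f-inj {a} {b} q = trans (sym (gf a)) (trans (cong g q) (gf b))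
    f' : Fin M → Fin M
    f' i = opposite (f i)
    f'-inj : ∀ {a b} → f' a ≡ f' b → a ≡ b
    f'-inj q = f-inj (trans (sym (FinP.opposite-involutive _)) (trans (cong opposite q) (FinP.opposite-involutive _)))
    f'-adj : ∀ i j → Consecutive i j → Adjacent (f' i) (f' j)
    f'-adj i j q = opposite-adjacent (f-adj i j q)
    by-end : (toℕ (f zero) ≡ 0) ⊎ (toℕ (f zero) ≡ suc m₀) → (∀ i → f i ≡ i) ⊎ (∀ i → f i ≡ opposite i)
    by-end (inj₁ e) = inj₁ (path-identity f f-inj f-adj e)
    by-end (inj₂ e) = inj₂ λ i → trans (sym (FinP.opposite-involutive (f i))) (cong opposite (path-identity f' f'-inj f'-adj f'0 i))
      where
      f'0 : toℕ (f' zero) ≡ 0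
      f'0 = trans (FinP.opposite-prop (f zero)) (trans (cong (λ w → M ∸ suc w) e) (ℕP.n∸n≡0 M))

  aut-dichotomy : (φ : Aut G) → (∀ i → perm φ i ≡ i) ⊎ (∀ i → perm φ i ≡ opposite i)
  aut-dichotomy φ = path-symmetry (perm φ) (perm (inv φ)) (perm-section φ) (perm-retraction φ)
                                  (perm-adjacent φ) (perm-adjacent (inv φ))

  canon-image : (φ : Aut G) → ∀ u → canon (proj₁ (Aut.to φ u)) ≡ canon (proj₁ u)
  canon-image φ u = by-cases (aut-dichotomy φ)
    where
    U = proj₁ (Aut.to φ u)
    by-cases : (∀ i → perm φ i ≡ i) ⊎ (∀ i → perm φ i ≡ opposite i) → canon U ≡ canon (proj₁ u)
    by-cases (inj₁ h) = cong canon (vec-ext {u = U} {v = proj₁ u} λ y → trans (cong (lookup U) (sym (h y))) (act φ u y))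
    by-cases (inj₂ h) = trans (cong canon (vec-ext {u = U} {v = reverse (proj₁ u)} λ y → begin
      lookup U y                          ≡⟨ cong (lookup U) (trans (h (opposite y)) (FinP.opposite-involutive y)) ⟨
      lookup U (perm φ (opposite y))      ≡⟨ act φ u (opposite y) ⟩
      lookup (proj₁ u) (opposite y)       ≡⟨ lookup-reverse (proj₁ u) y ⟨
      lookup (reverse (proj₁ u)) y        ∎)) (canon-reverse (proj₁ u))

  permute-opposite : ∀ (u : Vec Bool M) → permute opposite u ≡ reverse u
  permute-opposite u = vec-ext λ y → trans (lookup-permute opposite u y) (sym (lookup-reverse u y))

  reverse-aut : Aut G
  reverse-aut = PermAut.aut noCons opposite opposite FinP.opposite-involutive FinP.opposite-involutive keeps keeps
    where
    keeps : ∀ u → noCons u ≡ true → noCons (permute opposite u) ≡ true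
    keeps u h = trans (cong noCons (permute-opposite u)) (noCons-reverse u h)

  vertex-orbits : HasVertexOrbits G (card (Can {M}))
  vertex-orbits = rep , covering , distinct
    where
    C : Vec Bool M → Bool
    C = Can
    rep : Fin (card C) → V
    rep i = enum C i , ∧-l {noCons (enum C i)} (enum-P C i)
    covering : ∀ v → ∃ λ i → SameVOrbit G (rep i) v
    covering v = i , by-cases (canon-cases (proj₁ v))
      where
      found = enum-surj C (canon (proj₁ v)) (canon-Can (proj₁ v) (proj₂ v))
      i = proj₁ found
      by-cases : (canon (proj₁ v) ≡ proj₁ v) ⊎ (canon (proj₁ v) ≡ reverse (proj₁ v)) → SameVOrbit G (rep i) v
      by-cases (inj₁ x) = idAut , vertex-≡ (rep i) v (trans (proj₂ found) x)
      by-cases (inj₂ x) = reverse-aut , vertex-≡ (Aut.to reverse-aut (rep i)) v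
        (trans (permute-opposite (enum C i)) (trans (cong reverse (trans (proj₂ found) x)) (VecP.reverse-involutive (proj₁ v))))
    distinct : ∀ i j → SameVOrbit G (rep i) (rep j) → i ≡ j
    distinct i j (g , e) = enum-inj C i j (begin
      enum C i                          ≡⟨ canon-fix (enum C i) (enum-P C i) ⟨
      canon (enum C i)                  ≡⟨ canon-image g (rep i) ⟨
      canon (proj₁ (Aut.to g (rep i)))  ≡⟨ cong (λ w → canon (proj₁ w)) e ⟩
      canon (enum C j)                  ≡⟨ canon-fix (enum C j) (enum-P C j) ⟩
      enum C j                          ∎)

card-bij : ∀ {m m'} (P : Vec Bool m → Bool) (Q : Vec Bool m' → Bool)
           (f : Vec Bool m → Vec Bool m') (g : Vec Bool m' → Vec Bool m) →
           (∀ s → P s ≡ true → Q (f s) ≡ true) → (∀ w → Q w ≡ true → P (g w) ≡ true) →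
           (∀ s → P s ≡ true → g (f s) ≡ s) → (∀ w → Q w ≡ true → f (g w) ≡ w) → card P ≡ card Q
card-bij P Q f g PQ QP gf fg = card-≡ P Q f g PQ
  (λ s t hs ht e → trans (sym (gf s hs)) (trans (cong g e) (gf t ht))) QP
  (λ v w hv hw e → trans (sym (fg v hv)) (trans (cong f e) (fg w hw)))

card-reverse : ∀ {m} (P : Vec Bool m → Bool) → card (λ s → P (reverse s)) ≡ card P
card-reverse P = card-bij (λ s → P (reverse s)) P reverse reverse (λ s h → h)
  (λ s h → subst (λ w → P w ≡ true) (sym (VecP.reverse-involutive s)) h)
  (λ s _ → VecP.reverse-involutive s) (λ w _ → VecP.reverse-involutive w)

noCons-false∷ : ∀ {m} (s : Vec Bool m) → noCons (false ∷ s) ≡ noCons s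
noCons-false∷ [] = refl
noCons-false∷ (y ∷ s) = refl

card-noCons : ∀ m → card (noCons {m}) ≡ F (suc (suc m))
card-noCons zero = refl
card-noCons (suc zero) = refl
card-noCons (suc (suc m)) = cong₂ _+_
  (trans (card-cong (λ s → noCons (false ∷ s)) (noCons {suc m}) noCons-false∷) (card-noCons (suc m)))
  (trans (cong₂ _+_ (trans (card-cong (λ s → noCons (true ∷ false ∷ s)) (noCons {m}) starts-10) (card-noCons m))
                    (trans (card-cong (λ s → noCons (true ∷ true ∷ s)) (λ _ → false) starts-11) (card-false {m})))
         (ℕP.+-identityʳ (F (suc (suc m)))))
  where
  starts-10 : ∀ (s : Vec Bool m) → noCons (true ∷ false ∷ s) ≡ noCons s
  starts-10 [] = refl
  starts-10 (y ∷ s) = refl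
  starts-11 : ∀ (s : Vec Bool m) → noCons (true ∷ true ∷ s) ≡ false
  starts-11 [] = refl
  starts-11 (y ∷ s) = refl

Asc Desc Pal : ∀ {m} → Vec Bool m → Bool
Asc s = lexLe s (reverse s)
Desc s = lexLe (reverse s) s
Pal s = Asc s ∧ Desc s

PalFib : ∀ {m} → Vec Bool m → Bool
PalFib s = noCons s ∧ Pal s

-- Burnside for the reversal action: every non-palindromic Fibonacci string
-- has a strictly ascending partner (its reversal), so
-- 2 · #canonical = #Fibonacci + #palindromic.
twice-canonical : ∀ {m} → 2 * card (Can {m}) ≡ card (noCons {m}) + card (PalFib {m})
twice-canonical {m} = begin
  2 * card (Can {m})          ≡⟨ cong (2 *_) canonical ⟩
  2 * (X + Y)                 ≡⟨ cong ((X + Y) +_) (ℕP.+-identityʳ (X + Y)) ⟩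
  (X + Y) + (X + Y)           ≡⟨ cong ((X + Y) +_) (ℕP.+-comm X Y) ⟩
  (X + Y) + (Y + X)           ≡⟨ ℕP.+-assoc (X + Y) Y X ⟨
  ((X + Y) + Y) + X           ≡⟨ cong₂ _+_ fibonacci palindromic ⟨
  card (noCons {m}) + card (PalFib {m}) ∎
  where
  A : Vec Bool m → Bool
  A s = noCons s ∧ Asc s
  X = card (λ s → A s ∧ Desc s)
  Y = card (λ s → A s ∧ not (Desc s))
  canonical : card (Can {m}) ≡ X + Y
  canonical = card-split A Desc
  -- if s is not ascending it is descending
  absorb : ∀ a b c → (c ≡ false → b ≡ true) → a ∧ not c ≡ (a ∧ b) ∧ not c
  absorb a b true h = trans (∧-zeroʳ a) (sym (∧-zeroʳ (a ∧ b)))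
  absorb a b false h rewrite h refl = sym (∧-identityʳ (a ∧ true))
  -- non-ascending Fibonacci strings are reversals of strictly ascending ones
  descending : card (λ (s : Vec Bool m) → noCons s ∧ not (Asc s)) ≡ Y
  descending = trans (card-cong (λ s → noCons s ∧ not (Asc s)) (λ s → A (reverse s) ∧ not (Desc (reverse s))) pointwise)
                     (card-reverse (λ s → A s ∧ not (Desc s)))
    where
    pointwise : ∀ (s : Vec Bool m) → noCons s ∧ not (Asc s) ≡ A (reverse s) ∧ not (Desc (reverse s))
    pointwise s = trans (absorb (noCons s) (Desc s) (Asc s) (lex-total s (reverse s)))
      (sym (cong₂ (λ a b → a ∧ not b)
        (cong₂ _∧_ (noCons-reverse-≡ s) (cong (lexLe (reverse s)) (VecP.reverse-involutive s)))
        (cong (λ w → lexLe w (reverse s)) (VecP.reverse-involutive s))))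
  fibonacci : card (noCons {m}) ≡ (X + Y) + Y
  fibonacci = trans (card-split (noCons {m}) Asc) (cong₂ _+_ canonical descending)
  palindromic : card (PalFib {m}) ≡ X
  palindromic = card-cong (PalFib {m}) (λ s → A s ∧ Desc s) (λ s → sym (∧-assoc (noCons s) (Asc s) (Desc s)))

lex-∷ʳ : ∀ {n} (w v : Vec Bool n) a → lexLe (w ∷ʳ a) (v ∷ʳ a) ≡ lexLe w v
lex-∷ʳ [] [] true = refl
lex-∷ʳ [] [] false = refl
lex-∷ʳ (false ∷ w) (false ∷ v) a = lex-∷ʳ w v a
lex-∷ʳ (true ∷ w) (true ∷ v) a = lex-∷ʳ w v a
lex-∷ʳ (false ∷ w) (true ∷ v) a = refl
lex-∷ʳ (true ∷ w) (false ∷ v) a = refl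

lex-∷ : ∀ {n} a (x y : Vec Bool n) → lexLe (a ∷ x) (a ∷ y) ≡ lexLe x y
lex-∷ true x y = refl
lex-∷ false x y = refl

reverse-wrap : ∀ {n} a (w : Vec Bool n) → reverse (a ∷ (w ∷ʳ a)) ≡ a ∷ (reverse w ∷ʳ a)
reverse-wrap a w = trans (VecP.reverse-∷ a (w ∷ʳ a)) (cong (_∷ʳ a) (reverse-∷ʳ w a))

Pal-wrap : ∀ {n} a (w : Vec Bool n) → Pal (a ∷ (w ∷ʳ a)) ≡ Pal w
Pal-wrap a w = trans (cong (λ r → lexLe (a ∷ (w ∷ʳ a)) r ∧ lexLe r (a ∷ (w ∷ʳ a))) (reverse-wrap a w))
  (cong₂ _∧_ (trans (lex-∷ a (w ∷ʳ a) (reverse w ∷ʳ a)) (lex-∷ʳ w (reverse w) a))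
             (trans (lex-∷ a (reverse w ∷ʳ a) (w ∷ʳ a)) (lex-∷ʳ (reverse w) w a)))

Pal-ends : ∀ {n} a (s : Vec Bool (suc n)) → Pal (a ∷ s) ≡ true → s ≡ init s ∷ʳ a
Pal-ends a s h = trans (proj₂ (proj₂ (initLast s))) (cong (init s ∷ʳ_) last≡a)
  where
  palindrome : a ∷ s ≡ reverse s ∷ʳ a
  palindrome = trans (lex-antisym (a ∷ s) (reverse (a ∷ s)) (∧-l {Asc (a ∷ s)} h) (∧-r {Asc (a ∷ s)} h)) (VecP.reverse-∷ a s)
  last∷ : ∀ {n} (x : Bool) (t : Vec Bool (suc n)) → last (x ∷ t) ≡ last t
  last∷ x (y ∷ t) = refl
  last≡a : last s ≡ a
  last≡a = trans (sym (last∷ a s)) (trans (cong last palindrome) (VecP.last-∷ʳ a (reverse s)))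

noCons-∷ʳ-false-true : ∀ {k} (c : Vec Bool k) → noCons ((c ∷ʳ false) ∷ʳ true) ≡ noCons c
noCons-∷ʳ-false-true [] = refl
noCons-∷ʳ-false-true (x ∷ []) = trans (∧-identityʳ (not (x ∧ false))) (cong not (∧-zeroʳ x))
noCons-∷ʳ-false-true (x ∷ y ∷ c) = cong (not (x ∧ y) ∧_) (noCons-∷ʳ-false-true (y ∷ c))

-- A palindromic Fibonacci string of length L + 4 is either 0 w 0 with w of
-- length L + 2, or 1 0 w 0 1 with w of length L; hence the palindromic
-- counts satisfy the Fibonacci recursion with step 2.

wrap0 : ∀ {L} → Vec Bool L → Vec Bool (suc (suc L))
wrap0 w = false ∷ (w ∷ʳ false)

-- the part after the leading 1 of 1 0 w 0 1
wrap1 : ∀ {L} → Vec Bool L → Vec Bool (suc (suc (suc L)))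
wrap1 w = wrap0 w ∷ʳ true

unwrap1 : ∀ {L} → Vec Bool (suc (suc (suc L))) → Vec Bool L
unwrap1 s = init (tail (init s))

unwrap1-wrap1 : ∀ {L} (w : Vec Bool L) → unwrap1 (wrap1 w) ≡ w
unwrap1-wrap1 w = trans (cong (λ z → init (tail z)) (VecP.init-∷ʳ true (wrap0 w))) (VecP.init-∷ʳ false w)

PalFib-wrap0 : ∀ {L} (w : Vec Bool L) → PalFib (wrap0 w) ≡ PalFib w
PalFib-wrap0 w = cong₂ _∧_ (trans (noCons-false∷ (w ∷ʳ false)) (noCons-∷ʳ-false w)) (Pal-wrap false w)

PalFib-wrap1 : ∀ {L} (w : Vec Bool L) → PalFib (true ∷ wrap1 w) ≡ PalFib w
PalFib-wrap1 w = cong₂ _∧_ (trans (noCons-false∷ ((w ∷ʳ false) ∷ʳ true)) (noCons-∷ʳ-false-true w))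
                           (trans (Pal-wrap true (wrap0 w)) (Pal-wrap false w))

wrap1-unwrap1 : ∀ {L} (s : Vec Bool (suc (suc (suc L)))) → PalFib (true ∷ s) ≡ true → wrap1 (unwrap1 s) ≡ s
wrap1-unwrap1 {L} s h = sym (trans ends (cong (_∷ʳ true) (inner (init s) inner-Pal inner-Fib)))
  where
  ends : s ≡ init s ∷ʳ true
  ends = Pal-ends true s (∧-r {noCons (true ∷ s)} h)
  inner-Pal : Pal (init s) ≡ true
  inner-Pal = trans (sym (Pal-wrap true (init s))) (trans (cong (λ w → Pal (true ∷ w)) (sym ends)) (∧-r {noCons (true ∷ s)} h))
  inner-Fib : noCons (true ∷ (init s ∷ʳ true)) ≡ true
  inner-Fib = subst (λ w → noCons (true ∷ w) ≡ true) ends (∧-l {noCons (true ∷ s)} h)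
  -- the string between the outer ones starts (and so ends) with 0
  inner : ∀ (z : Vec Bool (suc (suc L))) → Pal z ≡ true → noCons (true ∷ (z ∷ʳ true)) ≡ true →
          z ≡ wrap0 (init (tail z))
  inner (true ∷ z') _ ()
  inner (false ∷ z') hp _ = cong (false ∷_) (Pal-ends false z' hp)

card-PalFib-0 : ∀ L → card (λ (s : Vec Bool (suc L)) → PalFib (false ∷ s)) ≡ card (PalFib {L})
card-PalFib-0 L = card-bij (λ s → PalFib (false ∷ s)) (PalFib {L}) init (_∷ʳ false)
  (λ s h → trans (sym (PalFib-wrap0 (init s))) (trans (cong (λ w → PalFib (false ∷ w)) (sym (ends s h))) h))
  (λ w h → trans (PalFib-wrap0 w) h)
  (λ s h → sym (ends s h))
  (λ w _ → VecP.init-∷ʳ false w)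
  where
  ends : ∀ (s : Vec Bool (suc L)) → PalFib (false ∷ s) ≡ true → s ≡ init s ∷ʳ false
  ends s h = Pal-ends false s (∧-r {noCons (false ∷ s)} h)

card-PalFib-1 : ∀ L → card (λ (s : Vec Bool (suc (suc (suc L)))) → PalFib (true ∷ s)) ≡ card (PalFib {L})
card-PalFib-1 L = card-bij (λ s → PalFib (true ∷ s)) (PalFib {L}) unwrap1 wrap1
  (λ s h → trans (sym (PalFib-wrap1 (unwrap1 s))) (trans (cong (λ w → PalFib (true ∷ w)) (wrap1-unwrap1 s h)) h))
  (λ w h → trans (PalFib-wrap1 w) h)
  wrap1-unwrap1
  (λ w _ → unwrap1-wrap1 w)

card-PalFib-step : ∀ L → card (PalFib {suc (suc (suc (suc L)))}) ≡ card (PalFib {suc (suc L)}) + card (PalFib {L})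
card-PalFib-step L = cong₂ _+_ (card-PalFib-0 (suc (suc L))) (card-PalFib-1 L)

sign-period : ∀ n → (ℤ.- ℤ.+ 1) ℤ.^ suc (suc n) ≡ (ℤ.- ℤ.+ 1) ℤ.^ n
sign-period n = trans (ℤP.-1*i≡-i (ℤ.-1ℤ ℤ.* x)) (trans (cong ℤ.-_ (ℤP.-1*i≡-i x)) (ℤP.neg-involutive x))
  where x = (ℤ.- ℤ.+ 1) ℤ.^ n

sign-cases : ∀ n → ((ℤ.- ℤ.+ 1) ℤ.^ n ≡ ℤ.+ 1) ⊎ ((ℤ.- ℤ.+ 1) ℤ.^ n ≡ ℤ.-[1+ 0 ])
sign-cases zero = inj₁ refl
sign-cases (suc n) with sign-cases n
... | inj₁ e = inj₂ (cong (ℤ.-1ℤ ℤ.*_) e)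
... | inj₂ e = inj₁ (cong (ℤ.-1ℤ ℤ.*_) e)

half-suc-suc : ∀ k → suc (suc k) / 2 ≡ suc (k / 2)
half-suc-suc k = m/n≡1+[m∸n]/n {suc (suc k)} {2} (s≤s (s≤s z≤n))

idx-step : ∀ n → idx (suc (suc n)) ≡ suc (idx n)
idx-step n = trans (cong (idxWith (suc (suc n))) (sign-period n)) (by-sign (sign-cases n))
  where
  idxWith : ℕ → ℤ.ℤ → ℕ
  idxWith k s = ℤ.∣ ℤ.+ k ℤ.+ ℤ.+ 1 ℤ.+ s ∣ / 2
  by-sign : ((ℤ.- ℤ.+ 1) ℤ.^ n ≡ ℤ.+ 1) ⊎ ((ℤ.- ℤ.+ 1) ℤ.^ n ≡ ℤ.-[1+ 0 ]) →
            idxWith (suc (suc n)) ((ℤ.- ℤ.+ 1) ℤ.^ n) ≡ suc (idx n)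
  by-sign (inj₁ e) = begin
    idxWith (suc (suc n)) ((ℤ.- ℤ.+ 1) ℤ.^ n)  ≡⟨ cong (idxWith (suc (suc n))) e ⟩
    suc (suc ((n + 1) + 1)) / 2                ≡⟨ half-suc-suc ((n + 1) + 1) ⟩
    suc (((n + 1) + 1) / 2)                    ≡⟨ cong (λ s → suc (idxWith n s)) e ⟨
    suc (idx n)                                ∎
  by-sign (inj₂ e) = begin
    idxWith (suc (suc n)) ((ℤ.- ℤ.+ 1) ℤ.^ n)  ≡⟨ cong (idxWith (suc (suc n))) e ⟩
    suc (n + 1) / 2                            ≡⟨ cong (λ k → suc k / 2) (ℕP.+-comm n 1) ⟩
    suc (suc n) / 2                            ≡⟨ half-suc-suc n ⟩
    suc (n / 2)                                ≡⟨ cong (λ k → suc (ℤ.∣ k ℤ.⊖ 1 ∣ / 2)) (ℕP.+-comm 1 n) ⟩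
    suc (ℤ.∣ (n + 1) ℤ.⊖ 1 ∣ / 2)              ≡⟨ cong (λ s → suc (idxWith n s)) e ⟨
    suc (idx n)                                ∎

card-PalFib : ∀ m → card (PalFib {m}) ≡ F (idx (suc (suc (suc m))))
card-PalFib zero = refl
card-PalFib (suc zero) = refl
card-PalFib (suc (suc zero)) = refl
card-PalFib (suc (suc (suc zero))) = refl
card-PalFib (suc (suc (suc (suc m)))) = begin
  card (PalFib {4 + m})                       ≡⟨ card-PalFib-step m ⟩
  card (PalFib {2 + m}) + card (PalFib {m})   ≡⟨ cong₂ _+_ (card-PalFib (suc (suc m))) (card-PalFib m) ⟩
  F (idx (5 + m)) + F (idx (3 + m))           ≡⟨ cong (λ k → F k + F (idx (3 + m))) (idx-step (3 + m)) ⟩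
  F (suc (idx (3 + m))) + F (idx (3 + m))     ≡⟨⟩
  F (suc (suc (idx (3 + m))))                 ≡⟨ cong F (trans (idx-step (5 + m)) (cong suc (idx-step (3 + m)))) ⟨
  F (idx (7 + m))                             ∎

count-canonical : ∀ m → 2 * card (Can {m}) ≡ F (suc (suc m)) + F (idx (suc (suc (suc m))))
count-canonical m = trans (twice-canonical {m}) (cong₂ _+_ (card-noCons m) (card-PalFib m))

-- Small cases.  Λ_1 has no edges; Λ_2 is the path 10 — 00 — 01, whose two
-- edges are exchanged by swapping the coordinates.

Λ₁-no-edge : Edge (Λ 1) → ⊥
Λ₁-no-edge ((true ∷ [] , ()) , _ , _)
Λ₁-no-edge ((false ∷ [] , _) , (true ∷ [] , ()) , _)
Λ₁-no-edge ((false ∷ [] , _) , (false ∷ [] , _) , ())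

Λ₁-edge-orbits : HasEdgeOrbits (Λ 1) 0
Λ₁-edge-orbits = (λ ()) , (λ e → ⊥-elim (Λ₁-no-edge e)) , λ ()

swap : Fin 2 → Fin 2
swap zero = suc zero
swap (suc zero) = zero

swap-invol : ∀ x → swap (swap x) ≡ x
swap-invol zero = refl
swap-invol (suc zero) = refl

swap-lucas : ∀ (u : Vec Bool 2) → lucasOk u ≡ true → lucasOk (permute swap u) ≡ true
swap-lucas (false ∷ false ∷ []) h = refl
swap-lucas (false ∷ true ∷ []) h = refl
swap-lucas (true ∷ false ∷ []) h = refl

swap-aut : Aut (Λ 2)
swap-aut = PermAut.aut lucasOk swap swap swap-invol swap-invol swap-lucas swap-lucas

Λ₂-edge : Edge (Λ 2)
Λ₂-edge = (false ∷ false ∷ [] , refl) , (true ∷ false ∷ [] , refl) , refl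

Λ₂-one-orbit : ∀ e → SameEOrbit (Λ 2) Λ₂-edge e
Λ₂-one-orbit ((false ∷ false ∷ [] , refl) , (true ∷ false ∷ [] , refl) , refl) = idAut , inj₁ (refl , refl)
Λ₂-one-orbit ((true ∷ false ∷ [] , refl) , (false ∷ false ∷ [] , refl) , refl) = idAut , inj₂ (refl , refl)
Λ₂-one-orbit ((false ∷ false ∷ [] , refl) , (false ∷ true ∷ [] , refl) , refl) = swap-aut , inj₁ (refl , refl)
Λ₂-one-orbit ((false ∷ true ∷ [] , refl) , (false ∷ false ∷ [] , refl) , refl) = swap-aut , inj₂ (refl , refl)
Λ₂-one-orbit ((true ∷ true ∷ [] , ()) , _ , _)
Λ₂-one-orbit (_ , (true ∷ true ∷ [] , ()) , _)
Λ₂-one-orbit ((false ∷ false ∷ [] , _) , (false ∷ false ∷ [] , _) , ())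
Λ₂-one-orbit ((true ∷ false ∷ [] , _) , (true ∷ false ∷ [] , _) , ())
Λ₂-one-orbit ((false ∷ true ∷ [] , _) , (false ∷ true ∷ [] , _) , ())
Λ₂-one-orbit ((true ∷ false ∷ [] , _) , (false ∷ true ∷ [] , _) , ())
Λ₂-one-orbit ((false ∷ true ∷ [] , _) , (true ∷ false ∷ [] , _) , ())

Λ₂-edge-orbits : HasEdgeOrbits (Λ 2) 1
Λ₂-edge-orbits = (λ _ → Λ₂-edge) , (λ e → zero , Λ₂-one-orbit e) , λ { zero zero _ → refl }

theorem5p9 : ((n : ℕ) → 5 ≤ n →
    ∃ λ k → HasEdgeOrbits (Λ n) k × HasVertexOrbits (Γ (n ∸ 3)) k)
    ×
    ((n : ℕ) → 1 ≤ n →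
    ∃ λ k → HasEdgeOrbits (Λ n) k × 2 * k ≡ F (n ∸ 1) + F (idx n))
theorem5p9 = part-i , part-ii
  where
  part-i : (n : ℕ) → 5 ≤ n → ∃ λ k → HasEdgeOrbits (Λ n) k × HasVertexOrbits (Γ (n ∸ 3)) k
  part-i n 5≤n with ℕP.m≤n⇒∃[o]m+o≡n 5≤n
  ... | m , refl = card (Can {2 + m}) , LucasEdges.edge-orbits (2 + m) , FibonacciCube.vertex-orbits m
  part-ii : (n : ℕ) → 1 ≤ n → ∃ λ k → HasEdgeOrbits (Λ n) k × 2 * k ≡ F (n ∸ 1) + F (idx n)
  part-ii (suc zero) _ = 0 , Λ₁-edge-orbits , refl
  part-ii (suc (suc zero)) _ = 1 , Λ₂-edge-orbits , refl
  part-ii (suc (suc (suc m))) _ = card (Can {m}) , LucasEdges.edge-orbits m , count-canonical m
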